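{- Let $m>1$ be an odd integer and let $p$ be the greatest prime dividing $m$. Then for every $\epsilon>0$, $$C_m(a)=o\!\left(a^{\log_p\left(\frac{p+1}{2}\right)+\epsilon}\right)\quad\text{as }a\to\infty.$$
   Context: For odd $m\in\mathbb{N}$ and $a\in\mathbb{N}$, $C_m(a)=\#\{0\le s<a : m\nmid\binom{2^{s+1}}{2^s}\}$.
   Formalization: The exponent $\log_p\left(\frac{p+1}{2}\right)+\epsilon$ ranges over rationals only, and the constant in the little-o bound ranges over positive rationals. -}

module Defs where

open import Data.Nat using (ℕ; zero; suc; _+_; _*_; _^_; _≤_; _<_)
open import Data.Nat.Divisibility using (_∣_; _∣?_)
open import Data.Nat.Combinatorics using (_C_)
open import Data.Nat.Primality using (Prime)
open import Data.List using (length; filter; upTo)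
open import Data.Product using (_×_)
open import Relation.Nullary using (¬_; ¬?)

centralBinom2 : ℕ → ℕ
centralBinom2 s = (2 ^ suc s) C (2 ^ s)

Cm : ℕ → ℕ → ℕ
Cm m a = length (filter (λ s → ¬? (m ∣? centralBinom2 s)) (upTo a))

IsGreatestPrimeFactor : ℕ → ℕ → Set
IsGreatestPrimeFactor p m = Prime p × p ∣ m × (∀ q → Prime q → q ∣ m → q ≤ p)

-- u / v > log_p((p+1)/2)   ⇔   p^u > ((p+1)/2)^v   ⇔   (p+1)^v < p^u * 2^v
AboveExponent : ℕ → ℕ → ℕ → Set
AboveExponent p u v = (p + 1) ^ v < p ^ u * 2 ^ v

-- Let q be an odd prime dividing m and h = (q + 1) / 2.  By Legendre's formula every
-- base-q digit of n that is ≥ h forces a carry when n is doubled, so q ^ k divides C(2n, n) as soon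
-- as n has k such digits.  The order of 2 modulo q ^ (c + L) is divisible by q ^ L, so over q ^ L
-- consecutive exponents s the residues 2 ^ s mod q ^ (c + L) are distinct; hence the s with
-- q ^ m ∤ C(2^(s+1), 2^s) inject into the residues with fewer than m big digits, and Rankin's trick
-- counts those as O((h (1 + 1/w)) ^ (c + L)).  Below a this gives O(a ^ (log_q h + ε)) such s.
-- Finally m ∤ C forces q ^ m ∤ C for some prime q ∣ m, and log_q((q + 1) / 2) increases with q.
module Submission where

open import Data.Bool using (Bool; true; false; not; _∧_; T)
open import Data.Bool.Properties using (∧-identityʳ; T-≡)
open import Data.Fin using (Fin; toℕ; fromℕ<) renaming (_<_ to _<ᶠ_)
open import Data.Fin.Properties using (pigeonhole; toℕ-fromℕ<)
open import Data.List using (length; filter; applyUpTo; []; _∷_)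
open import Data.List.Relation.Unary.All using (_∷_)
open import Data.Nat
open import Data.Nat.Combinatorics using (_C_; nCk≡n!/k![n-k]!; k![n∸k]!∣n!)
open import Data.Nat.Divisibility
open import Data.Nat.DivMod
open import Data.Nat.Induction using (<-rec)
open import Data.Nat.ListAction using (product)
open import Data.Nat.Primality
open import Data.Nat.Primality.Factorisation using (factorise)
open import Data.Nat.Properties
open import Data.Nat.Tactic.RingSolver using (solve-∀)
open import Data.Product using (∃-syntax; _×_; _,_; proj₁; proj₂)
open import Data.Sum using (inj₁; inj₂)
open import Function using (_∘_; id)
open import Function.Bundles using (Equivalence)
open import Relation.Binary.Definitions using (tri<; tri≈; tri>)
open import Relation.Binary.PropositionalEquality hiding (J)
open import Relation.Nullary using (¬_; Dec; yes; no; does; contradiction; ¬?)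

open import Defs

-- Finite sums and counting

∑ : (ℕ → ℕ) → ℕ → ℕ
∑ f zero = 0
∑ f (suc n) = f 0 + ∑ (f ∘ suc) n

fromBool : Bool → ℕ
fromBool true = 1
fromBool false = 0

count : (ℕ → Bool) → ℕ → ℕ
count P = ∑ (fromBool ∘ P)

∑-cong : ∀ {f g} n → (∀ i → i < n → f i ≡ g i) → ∑ f n ≡ ∑ g n
∑-cong zero eq = refl
∑-cong (suc n) eq = cong₂ _+_ (eq 0 z<s) (∑-cong n (λ i i<n → eq (suc i) (s<s i<n)))

∑-mono-≤ : ∀ {f g} n → (∀ i → i < n → f i ≤ g i) → ∑ f n ≤ ∑ g n
∑-mono-≤ zero le = z≤n
∑-mono-≤ (suc n) le = +-mono-≤ (le 0 z<s) (∑-mono-≤ n (λ i i<n → le (suc i) (s<s i<n)))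

∑-const : ∀ c n → ∑ (λ _ → c) n ≡ n * c
∑-const c zero = refl
∑-const c (suc n) = cong (c +_) (∑-const c n)

∑-zero : ∀ n → ∑ (λ _ → 0) n ≡ 0
∑-zero n = trans (∑-const 0 n) (*-zeroʳ n)

∑-+ : ∀ f g n → ∑ (λ i → f i + g i) n ≡ ∑ f n + ∑ g n
∑-+ f g zero = refl
∑-+ f g (suc n) = begin
  f 0 + g 0 + ∑ (λ i → f (suc i) + g (suc i)) n ≡⟨ cong (f 0 + g 0 +_) (∑-+ (f ∘ suc) (g ∘ suc) n) ⟩
  f 0 + g 0 + (∑ (f ∘ suc) n + ∑ (g ∘ suc) n)   ≡⟨ +-assoc-middle (f 0) (g 0) _ _ ⟩
  f 0 + ∑ (f ∘ suc) n + (g 0 + ∑ (g ∘ suc) n)   ∎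
  where
  open ≡-Reasoning
  +-assoc-middle : ∀ a b c d → a + b + (c + d) ≡ a + c + (b + d)
  +-assoc-middle = solve-∀

∑-*ˡ : ∀ c f n → ∑ (λ i → c * f i) n ≡ c * ∑ f n
∑-*ˡ c f zero = sym (*-zeroʳ c)
∑-*ˡ c f (suc n) = trans (cong (c * f 0 +_) (∑-*ˡ c (f ∘ suc) n)) (sym (*-distribˡ-+ c (f 0) _))

∑-swap : ∀ (F : ℕ → ℕ → ℕ) a b → ∑ (λ i → ∑ (F i) b) a ≡ ∑ (λ j → ∑ (λ i → F i j) a) b
∑-swap F zero b = sym (∑-zero b)
∑-swap F (suc a) b = trans (cong (∑ (F 0) b +_) (∑-swap (F ∘ suc) a b)) (sym (∑-+ (F 0) _ b))

∑-split : ∀ f a b → ∑ f (a + b) ≡ ∑ f a + ∑ (λ i → f (a + i)) b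
∑-split f zero b = refl
∑-split f (suc a) b = trans (cong (f 0 +_) (∑-split (f ∘ suc) a b)) (sym (+-assoc (f 0) _ _))

∑-block : ∀ f n T → ∑ f (n * T) ≡ ∑ (λ i → ∑ (λ j → f (i * T + j)) T) n
∑-block f zero T = refl
∑-block f (suc n) T = trans (∑-split f T (n * T)) (cong (∑ f T +_) (trans (∑-block (λ x → f (T + x)) n T)
  (∑-cong n (λ i _ → ∑-cong T (λ j _ → cong f (sym (+-assoc T (i * T) j)))))))

∑-monoʳ-≤ : ∀ f {a b} → a ≤ b → ∑ f a ≤ ∑ f b
∑-monoʳ-≤ f {a} a≤b with o , refl ← m≤n⇒∃[o]m+o≡n a≤b =
  subst (∑ f a ≤_) (sym (∑-split f a o)) (m≤m+n (∑ f a) _)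

term≤∑ : ∀ f {n i} → i < n → f i ≤ ∑ f n
term≤∑ f {suc n} {zero} _ = m≤m+n (f 0) _
term≤∑ f {suc n} {suc i} (s<s i<n) = ≤-trans (term≤∑ (f ∘ suc) i<n) (m≤n+m _ (f 0))

∑≤n*max : ∀ f n → 0 < n → ∃[ i ] (i < n × ∑ f n ≤ n * f i)
∑≤n*max f (suc zero) _ = 0 , z<s , ≤-refl
∑≤n*max f (suc (suc n)) _ with ∑≤n*max (f ∘ suc) (suc n) z<s
... | i , i<n , le with f 0 ≤? f (suc i)
...   | yes f0≤ = suc i , s<s i<n , +-mono-≤ f0≤ le
...   | no f0> = 0 , z<s , +-monoʳ-≤ (f 0) (≤-trans le (*-monoʳ-≤ (suc n) (<⇒≤ (≰⇒> f0>))))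

length-filter : ∀ {P : ℕ → Set} (P? : ∀ x → Dec (P x)) f n →
  length (filter P? (applyUpTo f n)) ≡ count (λ i → does (P? (f i))) n
length-filter P? f zero = refl
length-filter P? f (suc n) with does (P? (f 0))
... | true = cong suc (length-filter P? (f ∘ suc) n)
... | false = length-filter P? (f ∘ suc) n

count-remove : ∀ (W : ℕ → Bool) {Q x} → x < Q → W x ≡ true →
  count W Q ≡ suc (count (λ r → W r ∧ not (r ≡ᵇ x)) Q)
count-remove W {suc Q} {zero} _ Wx rewrite Wx = cong suc (∑-cong Q (λ i _ → cong fromBool (sym (∧-identityʳ (W (suc i))))))
count-remove W {suc Q} {suc x} (s<s x<Q) Wx with W 0
... | true = cong suc (count-remove (W ∘ suc) x<Q Wx)
... | false = count-remove (W ∘ suc) x<Q Wx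

InjectiveOn : (ℕ → Bool) → (ℕ → ℕ) → ℕ → Set
InjectiveOn P f n = ∀ {i j} → i < n → j < n → P i ≡ true → P j ≡ true → f i ≡ f j → i ≡ j

InjectiveOn-suc : ∀ {P f n} → InjectiveOn P f (suc n) → InjectiveOn (P ∘ suc) (f ∘ suc) n
InjectiveOn-suc inj i<n j<n Pi Pj e = suc-injective (inj (s<s i<n) (s<s j<n) Pi Pj e)

count-≤-injection : ∀ (P W : ℕ → Bool) (f : ℕ → ℕ) n Q →
  (∀ i → i < n → P i ≡ true → f i < Q × W (f i) ≡ true) → InjectiveOn P f n →
  count P n ≤ count W Q
count-≤-injection P W f zero Q into inj = z≤n
count-≤-injection P W f (suc n) Q into inj with P 0 in P0
... | false = count-≤-injection (P ∘ suc) W (f ∘ suc) n Q (λ i i<n → into (suc i) (s<s i<n)) (InjectiveOn-suc inj)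
... | true = begin
    suc (count (P ∘ suc) n)  ≤⟨ s≤s (count-≤-injection (P ∘ suc) W′ (f ∘ suc) n Q into′ (InjectiveOn-suc inj)) ⟩
    suc (count W′ Q)         ≡⟨ count-remove W f0<Q Wf0 ⟨
    count W Q                ∎
  where
  open ≤-Reasoning
  f0<Q : f 0 < Q
  f0<Q = proj₁ (into 0 z<s P0)
  Wf0 : W (f 0) ≡ true
  Wf0 = proj₂ (into 0 z<s P0)
  W′ : ℕ → Bool
  W′ r = W r ∧ not (r ≡ᵇ f 0)
  fsuc≢f0 : ∀ i → i < n → P (suc i) ≡ true → (f (suc i) ≡ᵇ f 0) ≡ false
  fsuc≢f0 i i<n Pi with f (suc i) ≡ᵇ f 0 in e
  ... | false = refl
  ... | true with () ← inj (s<s i<n) z<s Pi P0 (≡ᵇ⇒≡ (f (suc i)) (f 0) (subst T (sym e) _))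
  into′ : ∀ i → i < n → P (suc i) ≡ true → f (suc i) < Q × W′ (f (suc i)) ≡ true
  into′ i i<n Pi with into (suc i) (s<s i<n) Pi
  ... | lt , Wt rewrite Wt | fsuc≢f0 i i<n Pi = lt , refl

-- Divisibility

^-monoʳ-∣ : ∀ r {m n} → m ≤ n → r ^ m ∣ r ^ n
^-monoʳ-∣ r {m} m≤n with o , refl ← m≤n⇒∃[o]m+o≡n m≤n = divides (r ^ o) (trans (^-distribˡ-+-* r m o) (*-comm (r ^ m) (r ^ o)))

prime^-cancelˡ-∣ : ∀ {r a} → Prime r → ¬ r ∣ a → ∀ n x → r ^ n ∣ a * x → r ^ n ∣ x
prime^-cancelˡ-∣ pr r∤a zero x _ = 1∣ x
prime^-cancelˡ-∣ {r} {a} pr r∤a (suc n) x r^n∣ax with euclidsLemma a x pr (∣-trans (m∣m*n (r ^ n)) r^n∣ax)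
... | inj₁ r∣a = contradiction r∣a r∤a
... | inj₂ (divides x′ refl) =
  subst (r * r ^ n ∣_) (*-comm r x′) (*-monoʳ-∣ r (prime^-cancelˡ-∣ pr r∤a n x′ (*-cancelˡ-∣ r {{prime⇒nonZero pr}} r^[1+n]∣rax′)))
  where
  r^[1+n]∣rax′ : r * r ^ n ∣ r * (a * x′)
  r^[1+n]∣rax′ = subst (r * r ^ n ∣_) (reassoc a x′ r) r^n∣ax
    where
    reassoc : ∀ a x r → a * (x * r) ≡ r * (a * x)
    reassoc = solve-∀

∃prime∣ : ∀ m → 2 ≤ m → ∃[ q ] (Prime q × q ∣ m)
∃prime∣ m 2≤m with factorise m {{>-nonZero (≤-trans (s≤s z≤n) 2≤m)}}
... | record { factors = [] ; isFactorisation = eq } = contradiction (subst (2 ≤_) eq 2≤m) λ { (s≤s ()) }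
... | record { factors = p ∷ ps ; isFactorisation = eq ; factorsPrime = p-prime ∷ _ } =
  p , p-prime , divides (product ps) (trans eq (*-comm p (product ps)))

prime∣prime⇒≡ : ∀ {r q} → Prime r → Prime q → r ∣ q → r ≡ q
prime∣prime⇒≡ pr pq r∣q with prime⇒irreducible pq r∣q
... | inj₂ r≡q = r≡q
... | inj₁ refl = contradiction pr λ p → <⇒≢ (nonTrivial⇒n>1 1 {{prime⇒nonTrivial p}}) refl

all-prime^m∣⇒m∣ : ∀ m → 1 ≤ m → ∀ C → (∀ q → Prime q → q ∣ m → q ^ m ∣ C) → m ∣ C
all-prime^m∣⇒m∣ = <-rec _ step
  where
  step : ∀ m → (∀ {m′} → m′ < m → 1 ≤ m′ → ∀ C → (∀ q → Prime q → q ∣ m′ → q ^ m′ ∣ C) → m′ ∣ C) →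
         1 ≤ m → ∀ C → (∀ q → Prime q → q ∣ m → q ^ m ∣ C) → m ∣ C
  step (suc zero) _ _ C _ = 1∣ C
  step m@(suc (suc _)) rec _ C prime^m∣C with q , q-prime , divides m′ m≡m′q ← ∃prime∣ m (s≤s (s≤s z≤n)) =
    subst (_∣ C) (sym m≡m′q) (subst (m′ * q ∣_) (trans (*-comm C′ q) (sym C≡qC′)) (*-monoˡ-∣ q m′∣C′))
    where
    instance
      q≢0 : NonZero q
      q≢0 = prime⇒nonZero q-prime
    q∣m : q ∣ m
    q∣m = divides m′ m≡m′q
    1≤m′ : 1 ≤ m′
    1≤m′ = n≢0⇒n>0 (λ { refl → contradiction m≡m′q λ () })
    m′<m : m′ < m
    m′<m = subst (m′ <_) (sym m≡m′q) (m<m*n m′ q {{>-nonZero 1≤m′}} (nonTrivial⇒n>1 q {{prime⇒nonTrivial q-prime}}))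
    q∣C : q ∣ C
    q∣C = ∣-trans (m∣m*n _) (prime^m∣C q q-prime q∣m)
    C′ : ℕ
    C′ = quotient q∣C
    C≡qC′ : C ≡ q * C′
    C≡qC′ = m∣n⇒n≡m*quotient q∣C
    prime^m′∣C′ : ∀ r → Prime r → r ∣ m′ → r ^ m′ ∣ C′
    prime^m′∣C′ r r-prime r∣m′ with r ≟ q
    ... | yes refl = ∣-trans (^-monoʳ-∣ q (≤-pred m′<m)) (*-cancelˡ-∣ q (subst (q ^ m ∣_) C≡qC′ (prime^m∣C q q-prime q∣m)))
    ... | no r≢q = ∣-trans (^-monoʳ-∣ r (<⇒≤ m′<m))
          (prime^-cancelˡ-∣ r-prime (λ r∣q → r≢q (prime∣prime⇒≡ r-prime q-prime r∣q)) m C′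
            (subst (r ^ m ∣_) C≡qC′ (prime^m∣C r r-prime (∣-trans r∣m′ (divides q (trans m≡m′q (*-comm m′ q)))))))
    m′∣C′ : m′ ∣ C′
    m′∣C′ = rec m′<m 1≤m′ C′ prime^m′∣C′

-- Inequalities between powers

^-distribʳ-* : ∀ a b n → (a * b) ^ n ≡ a ^ n * b ^ n
^-distribʳ-* a b zero = refl
^-distribʳ-* a b (suc n) = trans (cong (a * b *_) (^-distribʳ-* a b n)) (interchange a b (a ^ n) (b ^ n))
  where
  interchange : ∀ a b c d → a * b * (c * d) ≡ a * c * (b * d)
  interchange = solve-∀

^-cancelʳ-≤ : ∀ n {a b} → 1 ≤ n → a ^ n ≤ b ^ n → a ≤ b
^-cancelʳ-≤ n {a} {b} 1≤n aⁿ≤bⁿ with a ≤? b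
... | yes a≤b = a≤b
... | no a≰b = contradiction aⁿ≤bⁿ (<⇒≱ (^-monoˡ-< n {{>-nonZero 1≤n}} (≰⇒> a≰b)))

^-cancelʳ-< : ∀ n {a b} → a ^ n < b ^ n → a < b
^-cancelʳ-< n {a} {b} aⁿ<bⁿ with a <? b
... | yes a<b = a<b
... | no a≮b = contradiction aⁿ<bⁿ (≤⇒≯ (^-monoˡ-≤ n (≮⇒≥ a≮b)))

m^n≥1 : ∀ m n → 1 ≤ m → 1 ≤ m ^ n
m^n≥1 m n 1≤m = m^n>0 m {{>-nonZero 1≤m}} n

-- Bernoulli's inequality (1 - 1/(M+1))^n ≥ 1 - n/(M+1), multiplied by (M+1)^(n+1).
bernoulli : ∀ M n → (M + 1) ^ suc n ≤ M ^ n * (M + 1) + n * (M + 1) ^ n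
bernoulli M zero = ≤-reflexive (base M)
  where
  base : ∀ M → (M + 1) * 1 ≡ 1 * (M + 1) + 0 * 1
  base = solve-∀
bernoulli M (suc n) = +-cancelʳ-≤ (n * M * Y) _ _ (begin
    (M + 1) * ((M + 1) * Y) + n * M * Y             ≤⟨ m≤m+n _ (n * Y) ⟩
    (M + 1) * ((M + 1) * Y) + n * M * Y + n * Y     ≡⟨ regroup₁ M n Y ⟩
    M * ((M + 1) * Y) + suc n * ((M + 1) * Y)       ≤⟨ +-monoˡ-≤ _ (*-monoʳ-≤ M (bernoulli M n)) ⟩
    M * (Z * (M + 1) + n * Y) + suc n * ((M + 1) * Y) ≡⟨ regroup₂ M n Y Z ⟩
    M * Z * (M + 1) + suc n * ((M + 1) * Y) + n * M * Y ∎)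
  where
  open ≤-Reasoning
  Y Z : ℕ
  Y = (M + 1) ^ n
  Z = M ^ n
  regroup₁ : ∀ M n Y → (M + 1) * ((M + 1) * Y) + n * M * Y + n * Y ≡ M * ((M + 1) * Y) + (1 + n) * ((M + 1) * Y)
  regroup₁ = solve-∀
  regroup₂ : ∀ M n Y Z → M * (Z * (M + 1) + n * Y) + (1 + n) * ((M + 1) * Y) ≡ M * Z * (M + 1) + (1 + n) * ((M + 1) * Y) + n * M * Y
  regroup₂ = solve-∀

-- (1 + 1/x)^x ≤ (1 + 1/(x+1))^(x+1), multiplied by x^x (x+1)^(x+1).
[1+1/x]^x-increasing : ∀ x → (x + 1) ^ (x + (x + 1)) ≤ x ^ x * (x + 2) ^ (x + 1)
[1+1/x]^x-increasing x = begin
  (x + 1) ^ (x + (x + 1))    ≡⟨ cong ((x + 1) ^_) (+-assoc x x 1) ⟨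
  (x + 1) ^ (x + x + 1)      ≡⟨ trans (^-distribˡ-+-* (x + 1) (x + x) 1) (cong₂ _*_ (^-distribˡ-+-* (x + 1) x x) (*-identityʳ (x + 1))) ⟩
  (x + 1) ^ x * (x + 1) ^ x * (x + 1) ≡⟨ cong (_* (x + 1)) (^-distribʳ-* (x + 1) (x + 1) x) ⟨
  N ^ x * (x + 1)            ≤⟨ squared ⟩
  M ^ x * (x + 2)            ≡⟨ cong (_* (x + 2)) (^-distribʳ-* x (x + 2) x) ⟩
  x ^ x * (x + 2) ^ x * (x + 2) ≡⟨ trans (*-assoc (x ^ x) _ _) (cong (x ^ x *_) (sym (trans (^-distribˡ-+-* (x + 2) x 1) (cong ((x + 2) ^ x *_) (*-identityʳ (x + 2)))))) ⟩
  x ^ x * (x + 2) ^ (x + 1)  ∎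
  where
  open ≤-Reasoning
  M N : ℕ
  M = x * (x + 2)
  N = (x + 1) * (x + 1)
  N≡M+1 : N ≡ M + 1
  N≡M+1 = square x
    where
    square : ∀ x → (x + 1) * (x + 1) ≡ x * (x + 2) + 1
    square = solve-∀
  bernoulli-N : N * N ^ x ≤ M ^ x * N + x * N ^ x
  bernoulli-N = subst (λ z → z * z ^ x ≤ M ^ x * z + x * z ^ x) (sym N≡M+1) (bernoulli M x)
  squared : N ^ x * (x + 1) ≤ M ^ x * (x + 2)
  squared = *-cancelʳ-≤ _ _ N {{>-nonZero (subst (1 ≤_) (sym N≡M+1) (m≤n+m 1 M))}} (+-cancelʳ-≤ (M * N ^ x) _ _ (begin
    N ^ x * (x + 1) * N + M * N ^ x       ≡⟨ regroup₁ (N ^ x) x N M ⟩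
    N ^ x * ((x + 1) * N + M)             ≤⟨ *-monoʳ-≤ (N ^ x) (+-monoʳ-≤ ((x + 1) * N) (≤-trans (n≤1+n M) (≤-reflexive (trans (+-comm 1 M) (sym N≡M+1))))) ⟩
    N ^ x * ((x + 1) * N + N)             ≡⟨ regroup₂ (N ^ x) N x ⟩
    N * N ^ x * (x + 2)                   ≤⟨ *-monoˡ-≤ (x + 2) bernoulli-N ⟩
    (M ^ x * N + x * N ^ x) * (x + 2)     ≡⟨ regroup₃ (M ^ x) N x (N ^ x) ⟩
    M ^ x * (x + 2) * N + M * N ^ x       ∎))
    where
    regroup₁ : ∀ P x N M → P * (x + 1) * N + M * P ≡ P * ((x + 1) * N + M)
    regroup₁ = solve-∀
    regroup₂ : ∀ P N x → P * ((x + 1) * N + N) ≡ N * P * (x + 2)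
    regroup₂ = solve-∀
    regroup₃ : ∀ Q N x P → (Q * N + x * P) * (x + 2) ≡ Q * (x + 2) * N + x * (x + 2) * P
    regroup₃ = solve-∀

-- (x+1)^v / x^u ≤ (x+2)^v / (x+1)^u as soon as u/v ≤ x/(x+1): raise [1+1/x]^x-increasing to the power u.
ratio-step : ∀ x u v → 1 ≤ x → u * (x + 1) ≤ v * x → (x + 1) ^ (u + v) ≤ x ^ u * (x + 2) ^ v
ratio-step x u v 1≤x u[x+1]≤vx with δ , δ-eq ← m≤n⇒∃[o]m+o≡n u[x+1]≤vx = ^-cancelʳ-≤ x 1≤x (begin
  ((x + 1) ^ (u + v)) ^ x                         ≡⟨ ^-*-assoc (x + 1) (u + v) x ⟩
  (x + 1) ^ ((u + v) * x)                         ≡⟨ cong ((x + 1) ^_) exponent ⟩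
  (x + 1) ^ ((x + (x + 1)) * u + δ)               ≡⟨ ^-distribˡ-+-* (x + 1) ((x + (x + 1)) * u) δ ⟩
  (x + 1) ^ ((x + (x + 1)) * u) * (x + 1) ^ δ     ≡⟨ cong (_* (x + 1) ^ δ) (^-*-assoc (x + 1) (x + (x + 1)) u) ⟨
  ((x + 1) ^ (x + (x + 1))) ^ u * (x + 1) ^ δ     ≤⟨ *-mono-≤ (^-monoˡ-≤ u ([1+1/x]^x-increasing x)) (^-monoˡ-≤ δ (+-monoʳ-≤ x (s≤s z≤n))) ⟩
  (x ^ x * (x + 2) ^ (x + 1)) ^ u * (x + 2) ^ δ   ≡⟨ cong (_* (x + 2) ^ δ) (^-distribʳ-* (x ^ x) _ u) ⟩
  (x ^ x) ^ u * ((x + 2) ^ (x + 1)) ^ u * (x + 2) ^ δ ≡⟨ cong₂ (λ a b → a * b * (x + 2) ^ δ) (^-*-assoc x x u) (^-*-assoc (x + 2) (x + 1) u) ⟩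
  x ^ (x * u) * (x + 2) ^ ((x + 1) * u) * (x + 2) ^ δ ≡⟨ *-assoc (x ^ (x * u)) _ _ ⟩
  x ^ (x * u) * ((x + 2) ^ ((x + 1) * u) * (x + 2) ^ δ) ≡⟨ cong (x ^ (x * u) *_) (^-distribˡ-+-* (x + 2) ((x + 1) * u) δ) ⟨
  x ^ (x * u) * (x + 2) ^ ((x + 1) * u + δ)       ≡⟨ cong₂ (λ a b → x ^ a * (x + 2) ^ b) (*-comm x u) (trans (cong (_+ δ) (*-comm (x + 1) u)) (trans δ-eq (*-comm v x))) ⟩
  x ^ (u * x) * (x + 2) ^ (x * v)                 ≡⟨ cong₂ _*_ (^-*-assoc x u x) (trans (^-*-assoc (x + 2) v x) (cong ((x + 2) ^_) (*-comm v x))) ⟨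
  (x ^ u) ^ x * ((x + 2) ^ v) ^ x                 ≡⟨ ^-distribʳ-* (x ^ u) _ x ⟨
  (x ^ u * (x + 2) ^ v) ^ x                       ∎)
  where
  open ≤-Reasoning
  exponent : (u + v) * x ≡ (x + (x + 1)) * u + δ
  exponent = trans (*-distribʳ-+ x u v) (trans (cong (u * x +_) (sym δ-eq)) (regroup u x δ))
    where
    regroup : ∀ u x δ → u * x + (u * (x + 1) + δ) ≡ (x + (x + 1)) * u + δ
    regroup = solve-∀

ratio-mono : ∀ q u v d → 1 ≤ q → u * (q + 1) ≤ v * q → (q + 1) ^ v * (q + d) ^ u ≤ q ^ u * (q + d + 1) ^ v
ratio-mono q u v zero 1≤q _ = ≤-reflexive (begin-equality
  (q + 1) ^ v * (q + 0) ^ u ≡⟨ cong (λ z → (q + 1) ^ v * z ^ u) (+-identityʳ q) ⟩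
  (q + 1) ^ v * q ^ u       ≡⟨ *-comm ((q + 1) ^ v) (q ^ u) ⟩
  q ^ u * (q + 1) ^ v       ≡⟨ cong (λ z → q ^ u * (z + 1) ^ v) (+-identityʳ q) ⟨
  q ^ u * (q + 0 + 1) ^ v   ∎)
  where open ≤-Reasoning
ratio-mono q u v (suc d) 1≤q u[q+1]≤vq = *-cancelʳ-≤ _ _ W {{>-nonZero 1≤W}} (begin
  (q + 1) ^ v * (q + suc d) ^ u * W                 ≡⟨ cong (λ z → (q + 1) ^ v * z ^ u * W) q+1+d≡x+1 ⟩
  (q + 1) ^ v * (x + 1) ^ u * (x ^ u * (x + 1) ^ v) ≡⟨ regroup₁ ((q + 1) ^ v) ((x + 1) ^ u) (x ^ u) ((x + 1) ^ v) ⟩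
  ((q + 1) ^ v * x ^ u) * ((x + 1) ^ u * (x + 1) ^ v) ≡⟨ cong (((q + 1) ^ v * x ^ u) *_) (^-distribˡ-+-* (x + 1) u v) ⟨
  ((q + 1) ^ v * x ^ u) * (x + 1) ^ (u + v)         ≤⟨ *-mono-≤ (ratio-mono q u v d 1≤q u[q+1]≤vq) (ratio-step x u v 1≤x u[x+1]≤vx) ⟩
  (q ^ u * (x + 1) ^ v) * (x ^ u * (x + 2) ^ v)     ≡⟨ regroup₂ (q ^ u) ((x + 1) ^ v) (x ^ u) ((x + 2) ^ v) ⟩
  q ^ u * (x + 2) ^ v * W                           ≡⟨ cong (λ z → q ^ u * z ^ v * W) (trans (cong (_+ 1) q+1+d≡x+1) (+-assoc x 1 1)) ⟨
  q ^ u * (q + suc d + 1) ^ v * W                   ∎)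
  where
  open ≤-Reasoning
  x W : ℕ
  x = q + d
  W = x ^ u * (x + 1) ^ v
  1≤x : 1 ≤ x
  1≤x = ≤-trans 1≤q (m≤m+n q d)
  1≤W : 1 ≤ W
  1≤W = *-mono-≤ (m^n≥1 x u 1≤x) (m^n≥1 (x + 1) v (m≤n+m 1 x))
  q+1+d≡x+1 : q + suc d ≡ x + 1
  q+1+d≡x+1 = trans (+-suc q d) (+-comm 1 x)
  u≤v : u ≤ v
  u≤v = *-cancelʳ-≤ u v q {{>-nonZero 1≤q}} (≤-trans (*-monoʳ-≤ u (m≤m+n q 1)) u[q+1]≤vq)
  u[x+1]≤vx : u * (x + 1) ≤ v * x
  u[x+1]≤vx = begin
    u * (x + 1)          ≡⟨ distrib u q d ⟩
    u * (q + 1) + u * d  ≤⟨ +-mono-≤ u[q+1]≤vq (*-monoˡ-≤ d u≤v) ⟩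
    v * q + v * d        ≡⟨ *-distribˡ-+ v q d ⟨
    v * x                ∎
    where
    distrib : ∀ u q d → u * (q + d + 1) ≡ u * (q + 1) + u * d
    distrib = solve-∀
  regroup₁ : ∀ a b c d → a * b * (c * d) ≡ (a * c) * (b * d)
  regroup₁ = solve-∀
  regroup₂ : ∀ a b c d → (a * b) * (c * d) ≡ a * d * (c * b)
  regroup₂ = solve-∀

[q+1]^[q+1]≤2^[q+1]*q^q : ∀ q → 2 ≤ q → suc q ^ suc q ≤ 2 ^ suc q * q ^ q
[q+1]^[q+1]≤2^[q+1]*q^q q 2≤q with t , refl ← m≤n⇒∃[o]m+o≡n 2≤q = from-2 t
  where
  from-2 : ∀ t → suc (2 + t) ^ suc (2 + t) ≤ 2 ^ suc (2 + t) * (2 + t) ^ (2 + t)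
  from-2 zero = ≤ᵇ⇒≤ 27 32 _
  from-2 (suc t) = *-cancelʳ-≤ _ _ (a ^ a) {{>-nonZero (m^n≥1 a a (s≤s z≤n))}} (begin
    (2 + a) * ((2 + a) * (2 + a) ^ a) * a ^ a    ≡⟨ regroup₁ (2 + a) ((2 + a) ^ a) (a ^ a) ⟩
    (a ^ a * (2 + a) ^ a) * ((2 + a) * (2 + a))  ≤⟨ *-mono-≤ power-bound square-bound ⟩
    (suc a ^ a * suc a ^ a) * (2 * (suc a * suc a)) ≡⟨ regroup₂ (suc a ^ a) (suc a) ⟩
    2 * (suc a * suc a ^ a) * (suc a * suc a ^ a) ≤⟨ *-monoʳ-≤ (2 * (suc a * suc a ^ a)) (from-2 t) ⟩
    2 * (suc a * suc a ^ a) * (2 * 2 ^ a * a ^ a) ≡⟨ regroup₃ (suc a * suc a ^ a) (2 ^ a) (a ^ a) ⟩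
    2 * (2 * 2 ^ a) * (suc a * suc a ^ a) * a ^ a ∎)
    where
    open ≤-Reasoning
    a : ℕ
    a = 2 + t
    power-bound : a ^ a * (2 + a) ^ a ≤ suc a ^ a * suc a ^ a
    power-bound = begin
      a ^ a * (2 + a) ^ a    ≡⟨ ^-distribʳ-* a (2 + a) a ⟨
      (a * (2 + a)) ^ a      ≤⟨ ^-monoˡ-≤ a (≤-trans (n≤1+n _) (≤-reflexive (square a))) ⟩
      (suc a * suc a) ^ a    ≡⟨ ^-distribʳ-* (suc a) (suc a) a ⟩
      suc a ^ a * suc a ^ a  ∎
      where
      square : ∀ a → suc (a * (2 + a)) ≡ (1 + a) * (1 + a)
      square = solve-∀
    square-bound : (2 + a) * (2 + a) ≤ 2 * (suc a * suc a)
    square-bound = ≤-trans (m≤m+n _ (t * t + 4 * t + 2)) (≤-reflexive (squares t))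
      where
      squares : ∀ t → (4 + t) * (4 + t) + (t * t + 4 * t + 2) ≡ 2 * ((3 + t) * (3 + t))
      squares = solve-∀
    regroup₁ : ∀ b X Y → b * (b * X) * Y ≡ (Y * X) * (b * b)
    regroup₁ = solve-∀
    regroup₂ : ∀ Z b → (Z * Z) * (2 * (b * b)) ≡ 2 * (b * Z) * (b * Z)
    regroup₂ = solve-∀
    regroup₃ : ∀ P T Y → 2 * P * (2 * T * Y) ≡ 2 * (2 * T) * P * Y
    regroup₃ = solve-∀

aboveExponent-of-u[q+1]>vq : ∀ q u v → 2 ≤ q → v * q < u * suc q → AboveExponent q u v
aboveExponent-of-u[q+1]>vq q u v 2≤q vq<u[q+1] with δ′ , δ-eq ← m≤n⇒∃[o]m+o≡n vq<u[q+1] =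
  subst (λ z → z ^ v < q ^ u * 2 ^ v) (+-comm 1 q) (^-cancelʳ-< q (begin-strict
    (suc q ^ v) ^ q               ≡⟨ ^-*-assoc (suc q) v q ⟩
    suc q ^ (v * q)               <⟨ *-cancelʳ-< (suc q ^ δ) _ _ (≤-<-trans bound (*-monoʳ-< P {{>-nonZero 1≤P}} (^-monoˡ-< δ (s≤s 2≤q)))) ⟩
    P                             ≡⟨ ^-distribʳ-* (q ^ u) (2 ^ v) q ⟨
    (q ^ u * 2 ^ v) ^ q           ∎))
  where
  open ≤-Reasoning
  δ P : ℕ
  δ = suc δ′
  P = (q ^ u) ^ q * (2 ^ v) ^ q
  exponent : suc q * u ≡ v * q + δ
  exponent = trans (*-comm (suc q) u) (trans (sym δ-eq) (sym (+-suc (v * q) δ′)))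
  1≤P : 1 ≤ P
  1≤P = *-mono-≤ (m^n≥1 (q ^ u) q (m^n≥1 q u (≤-trans (s≤s z≤n) 2≤q))) (m^n≥1 (2 ^ v) q (m^n≥1 2 v (s≤s z≤n)))
  bound : suc q ^ (v * q) * suc q ^ δ ≤ P * 2 ^ δ
  bound = begin
    suc q ^ (v * q) * suc q ^ δ   ≡⟨ ^-distribˡ-+-* (suc q) (v * q) δ ⟨
    suc q ^ (v * q + δ)           ≡⟨ cong (suc q ^_) exponent ⟨
    suc q ^ (suc q * u)           ≡⟨ ^-*-assoc (suc q) (suc q) u ⟨
    (suc q ^ suc q) ^ u           ≤⟨ ^-monoˡ-≤ u ([q+1]^[q+1]≤2^[q+1]*q^q q 2≤q) ⟩
    (2 ^ suc q * q ^ q) ^ u       ≡⟨ ^-distribʳ-* (2 ^ suc q) (q ^ q) u ⟩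
    (2 ^ suc q) ^ u * (q ^ q) ^ u ≡⟨ cong₂ _*_ (trans (^-*-assoc 2 (suc q) u) (trans (cong (2 ^_) exponent) (^-distribˡ-+-* 2 (v * q) δ))) (^-*-assoc q q u) ⟩
    2 ^ (v * q) * 2 ^ δ * q ^ (q * u) ≡⟨ cong₂ (λ a b → b * 2 ^ δ * a) (trans (cong (q ^_) (*-comm q u)) (sym (^-*-assoc q u q))) (sym (^-*-assoc 2 v q)) ⟩
    (2 ^ v) ^ q * 2 ^ δ * (q ^ u) ^ q ≡⟨ regroup ((2 ^ v) ^ q) (2 ^ δ) ((q ^ u) ^ q) ⟩
    P * 2 ^ δ                     ∎
    where
    regroup : ∀ a b c → a * b * c ≡ c * a * b
    regroup = solve-∀

-- x ↦ log_x((x+1)/2) is increasing.  If u/v > q/(q+1) the claim holds outright; otherwise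
-- (x+1)^v / x^u is nondecreasing on [q, p] and (p+1)^v / p^u < 2^v.
aboveExponent-downward : ∀ {q p u v} → 2 ≤ q → q ≤ p → AboveExponent p u v → AboveExponent q u v
aboveExponent-downward {q} {p} {u} {v} 2≤q q≤p above-p with v * q <? u * suc q
... | yes vq<u[q+1] = aboveExponent-of-u[q+1]>vq q u v 2≤q vq<u[q+1]
... | no vq≮u[q+1] with d , refl ← m≤n⇒∃[o]m+o≡n q≤p = *-cancelʳ-< (p ^ u) _ _ (begin-strict
  (q + 1) ^ v * p ^ u       ≤⟨ ratio-mono q u v d (≤-trans (s≤s z≤n) 2≤q) u[q+1]≤vq ⟩
  q ^ u * (p + 1) ^ v       <⟨ *-monoʳ-< (q ^ u) {{>-nonZero (m^n≥1 q u (≤-trans (s≤s z≤n) 2≤q))}} above-p ⟩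
  q ^ u * (p ^ u * 2 ^ v)   ≡⟨ regroup (q ^ u) (p ^ u) (2 ^ v) ⟩
  q ^ u * 2 ^ v * p ^ u     ∎)
  where
  open ≤-Reasoning
  u[q+1]≤vq : u * (q + 1) ≤ v * q
  u[q+1]≤vq = subst (λ z → u * z ≤ v * q) (+-comm 1 q) (≮⇒≥ vq≮u[q+1])
  regroup : ∀ a b c → a * (b * c) ≡ a * c * b
  regroup = solve-∀

-- (1 + 1/w)^v ≤ 1 / (1 - v/w), multiplied by w^(v+1).
bernoulli-reverse : ∀ w v → (w + 1) ^ v * (w ∸ v) ≤ w ^ suc v
bernoulli-reverse w zero = ≤-reflexive (trans (+-identityʳ w) (sym (*-identityʳ w)))
bernoulli-reverse w (suc v) = begin
  (w + 1) * (w + 1) ^ v * (w ∸ suc v)    ≡⟨ regroup (w + 1) ((w + 1) ^ v) (w ∸ suc v) ⟩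
  (w + 1) ^ v * ((w + 1) * (w ∸ suc v))  ≤⟨ *-monoʳ-≤ ((w + 1) ^ v) (step w v) ⟩
  (w + 1) ^ v * ((w ∸ v) * w)            ≡⟨ *-assoc ((w + 1) ^ v) (w ∸ v) w ⟨
  (w + 1) ^ v * (w ∸ v) * w              ≤⟨ *-monoˡ-≤ w (bernoulli-reverse w v) ⟩
  w ^ suc v * w                          ≡⟨ *-comm (w ^ suc v) w ⟩
  w ^ suc (suc v)                        ∎
  where
  open ≤-Reasoning
  regroup : ∀ a b c → a * b * c ≡ b * (a * c)
  regroup = solve-∀
  step : ∀ w v → (w + 1) * (w ∸ suc v) ≤ (w ∸ v) * w
  step zero v = subst (λ z → 1 * z ≤ (0 ∸ v) * 0) (sym (0∸n≡0 (suc v))) z≤n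
  step (suc w) v with v ≤? w
  ... | no v≰w = subst (λ z → (suc w + 1) * z ≤ (suc w ∸ v) * suc w) (sym (m≤n⇒m∸n≡0 (<⇒≤ (≰⇒> v≰w))))
                   (subst (_≤ (suc w ∸ v) * suc w) (sym (*-zeroʳ (suc w + 1))) z≤n)
  ... | yes v≤w = subst (λ z → (suc w + 1) * (w ∸ v) ≤ z * suc w) (sym (+-∸-assoc 1 v≤w)) (small (m∸n≤m w v))
    where
    small : ∀ {a} → a ≤ w → (suc w + 1) * a ≤ suc a * suc w
    small {a} a≤w = subst₂ _≤_ (expand₁ a w) (expand₂ a w) (+-monoʳ-≤ (a * suc w) (m≤n⇒m≤1+n a≤w))
      where
      expand₁ : ∀ a w → a * suc w + a ≡ (suc w + 1) * a
      expand₁ = solve-∀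
      expand₂ : ∀ a w → a * suc w + suc w ≡ suc a * suc w
      expand₂ = solve-∀

∃w[h[1+1/w]]^v< : ∀ h v Y → h ^ v < Y → ∃[ w ] (1 ≤ w × (h * (w + 1)) ^ v < Y * w ^ v)
∃w[h[1+1/w]]^v< h v Y hᵛ<Y = w , 1≤w , (begin-strict
  (h * (w + 1)) ^ v          ≡⟨ ^-distribʳ-* h (w + 1) v ⟩
  X * (w + 1) ^ v            <⟨ *-cancelʳ-< (w ∸ v) _ _ scaled ⟩
  (X + 1) * w ^ v            ≤⟨ *-monoˡ-≤ (w ^ v) (subst (_≤ Y) (+-comm 1 X) hᵛ<Y) ⟩
  Y * w ^ v                  ∎)
  where
  open ≤-Reasoning
  X w : ℕ
  X = h ^ v
  w = (X * v + 1) + v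
  1≤w : 1 ≤ w
  1≤w = ≤-trans (m≤n+m 1 (X * v)) (m≤m+n _ v)
  w∸v≡ : w ∸ v ≡ X * v + 1
  w∸v≡ = m+n∸n≡m (X * v + 1) v
  Xw< : X * w < (X + 1) * (w ∸ v)
  Xw< = subst (X * w <_) (cong ((X + 1) *_) (sym w∸v≡)) (≤-reflexive (expand X v))
    where
    expand : ∀ X v → suc (X * ((X * v + 1) + v)) ≡ (X + 1) * (X * v + 1)
    expand = solve-∀
  scaled : X * (w + 1) ^ v * (w ∸ v) < (X + 1) * w ^ v * (w ∸ v)
  scaled = begin-strict
    X * (w + 1) ^ v * (w ∸ v)       ≡⟨ *-assoc X _ _ ⟩
    X * ((w + 1) ^ v * (w ∸ v))     ≤⟨ *-monoʳ-≤ X (bernoulli-reverse w v) ⟩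
    X * (w * w ^ v)                 ≡⟨ *-assoc X w (w ^ v) ⟨
    X * w * w ^ v                   <⟨ *-monoˡ-< (w ^ v) {{>-nonZero (m^n≥1 w v 1≤w)}} Xw< ⟩
    (X + 1) * (w ∸ v) * w ^ v       ≡⟨ regroup (X + 1) (w ∸ v) (w ^ v) ⟩
    (X + 1) * w ^ v * (w ∸ v)       ∎
    where
    regroup : ∀ a b c → a * b * c ≡ a * c * b
    regroup = solve-∀

-- Bernoulli's inequality (1 + 1/X)^L ≥ 1 + L/X, multiplied by X^(L+1).
bernoulli-lower : ∀ X L → X ^ L * (X + L) ≤ (X + 1) ^ L * X
bernoulli-lower X zero = ≤-reflexive (cong (_+ 0) (+-identityʳ X))
bernoulli-lower X (suc L) = begin
  X * X ^ L * (X + suc L)        ≡⟨ regroup₁ X (X ^ L) (X + suc L) ⟩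
  X ^ L * (X * (X + suc L))      ≤⟨ *-monoʳ-≤ (X ^ L) (≤-trans (m≤m+n _ L) (≤-reflexive (expand X L))) ⟩
  X ^ L * ((X + 1) * (X + L))    ≡⟨ regroup₂ (X ^ L) (X + 1) (X + L) ⟩
  (X + 1) * (X ^ L * (X + L))    ≤⟨ *-monoʳ-≤ (X + 1) (bernoulli-lower X L) ⟩
  (X + 1) * ((X + 1) ^ L * X)    ≡⟨ *-assoc (X + 1) _ X ⟨
  (X + 1) ^ suc L * X            ∎
  where
  open ≤-Reasoning
  regroup₁ : ∀ a b c → a * b * c ≡ b * (a * c)
  regroup₁ = solve-∀
  expand : ∀ X L → X * (X + suc L) + L ≡ (X + 1) * (X + L)
  expand = solve-∀
  regroup₂ : ∀ a b c → a * (b * c) ≡ b * (a * c)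
  regroup₂ = solve-∀

A*X^L<Y^L : ∀ A {X Y} L → 1 ≤ X → X < Y → A * X ≤ L → A * X ^ L < Y ^ L
A*X^L<Y^L A {X} {Y} L 1≤X X<Y AX≤L = <-≤-trans (*-cancelʳ-< X _ _ (begin-strict
    A * X ^ L * X      ≡⟨ regroup A (X ^ L) X ⟩
    X ^ L * (A * X)    ≤⟨ *-monoʳ-≤ (X ^ L) AX≤L ⟩
    X ^ L * L          <⟨ *-monoʳ-< (X ^ L) {{>-nonZero (m^n≥1 X L 1≤X)}} (m<n+m L 1≤X) ⟩
    X ^ L * (X + L)    ≤⟨ bernoulli-lower X L ⟩
    (X + 1) ^ L * X    ∎)) (^-monoˡ-≤ L (subst (_≤ Y) (+-comm 1 X) X<Y))
  where
  open ≤-Reasoning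
  regroup : ∀ a b c → a * b * c ≡ b * (a * c)
  regroup = solve-∀

∃⌊log⌋ : ∀ q a → 2 ≤ q → 1 ≤ a → ∃[ L ] (q ^ L ≤ a × a < q ^ suc L)
∃⌊log⌋ q (suc zero) 2≤q _ = 0 , ≤-refl , subst (1 <_) (sym (*-identityʳ q)) 2≤q
∃⌊log⌋ q (suc (suc a)) 2≤q _ with L , lo , hi ← ∃⌊log⌋ q (suc a) 2≤q (s≤s z≤n) | suc (suc a) <? q ^ suc L
... | yes 2+a<q^[1+L] = L , m≤n⇒m≤1+n lo , 2+a<q^[1+L]
... | no 2+a≮q^[1+L] = suc L , ≤-reflexive (sym 2+a≡q^[1+L]) , subst (_< q ^ suc (suc L)) (sym 2+a≡q^[1+L])
                          (subst (_< q ^ suc (suc L)) (*-identityˡ (q ^ suc L))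
                            (*-monoˡ-< (q ^ suc L) {{>-nonZero (m^n≥1 q (suc L) (≤-trans (s≤s z≤n) 2≤q))}} 2≤q))
  where
  2+a≡q^[1+L] : suc (suc a) ≡ q ^ suc L
  2+a≡q^[1+L] = ≤-antisym hi (≮⇒≥ 2+a≮q^[1+L])

-- Negligible functions

-- f a = o(a ^ (u / v)): for every e, eventually e * f a < a ^ (u / v).  A constant d / e as in
-- the theorem reduces to 1 / e because a ^ u ≤ d ^ v * a ^ u for d ≥ 1.
record Negligible (u v : ℕ) (f : ℕ → ℕ) : Set where
  constructor negligible
  field
    eventually-below : ∀ e → ∃[ N ] (∀ a → N ≤ a → (e * f a) ^ v < a ^ u)

open Negligible

eventually-all : ∀ n (P : ℕ → ℕ → Set) → (∀ q → q < n → ∃[ N ] (∀ a → N ≤ a → P q a)) →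
  ∃[ N ] (∀ a → N ≤ a → ∀ q → q < n → P q a)
eventually-all zero P ev = 0 , λ _ _ _ ()
eventually-all (suc n) P ev with eventually-all n P (λ q q<n → ev q (m≤n⇒m≤1+n q<n)) | ev n ≤-refl
... | N₁ , below-n | N₂ , at-n = N₁ + N₂ , all-q
  where
  all-q : ∀ a → N₁ + N₂ ≤ a → ∀ q → q < suc n → P q a
  all-q a N≤a q q<1+n with q ≟ n
  ... | yes refl = at-n a (≤-trans (m≤n+m N₂ N₁) N≤a)
  ... | no q≢n = below-n a (≤-trans (m≤m+n N₁ N₂) N≤a) q (≤∧≢⇒< (≤-pred q<1+n) q≢n)

negligible-≤ : ∀ {u v f g} → (∀ a → f a ≤ g a) → Negligible u v g → Negligible u v f
negligible-≤ {u} {v} {f} {g} f≤g (negligible g-below) = negligible λ e → f-below e (g-below e)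
  where
  f-below : ∀ e → ∃[ N ] (∀ a → N ≤ a → (e * g a) ^ v < a ^ u) → ∃[ N ] (∀ a → N ≤ a → (e * f a) ^ v < a ^ u)
  f-below e (N , below) = N , λ a N≤a → ≤-<-trans (^-monoˡ-≤ v (*-monoʳ-≤ e (f≤g a))) (below a N≤a)

negligible-0 : ∀ {u v} → 0 < v → Negligible u v (λ _ → 0)
negligible-0 {u} {suc v} _ = negligible λ e → 1 , λ a 1≤a → subst (λ z → z ^ suc v < a ^ u) (sym (*-zeroʳ e)) (m^n>0 a {{>-nonZero 1≤a}} u)

negligible-∑ : ∀ {u v} n (F : ℕ → ℕ → ℕ) → 0 < n → (∀ q → q < n → Negligible u v (F q)) →
  Negligible u v (λ a → ∑ (λ q → F q a) n)
negligible-∑ {u} {v} n F 0<n negl = negligible λ e → sum-below e (eventually-all n _ (λ q q<n → eventually-below (negl q q<n) (e * n)))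
  where
  sum-below : ∀ e → ∃[ N ] (∀ a → N ≤ a → ∀ q → q < n → (e * n * F q a) ^ v < a ^ u) →
              ∃[ N ] (∀ a → N ≤ a → (e * ∑ (λ q → F q a) n) ^ v < a ^ u)
  sum-below e (N , below) = N , bound
    where
    bound : ∀ a → N ≤ a → (e * ∑ (λ q → F q a) n) ^ v < a ^ u
    bound a N≤a with i , i<n , ∑≤ ← ∑≤n*max (λ q → F q a) n 0<n = begin-strict
      (e * ∑ (λ q → F q a) n) ^ v ≤⟨ ^-monoˡ-≤ v (*-monoʳ-≤ e ∑≤) ⟩
      (e * (n * F i a)) ^ v       ≡⟨ cong (_^ v) (*-assoc e n (F i a)) ⟨
      (e * n * F i a) ^ v         <⟨ below a N≤a i i<n ⟩
      a ^ u                       ∎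
      where open ≤-Reasoning

^-comm-exponents : ∀ x a b → (x ^ a) ^ b ≡ (x ^ b) ^ a
^-comm-exponents x a b = trans (^-*-assoc x a b) (trans (cong (x ^_) (*-comm a b)) (sym (^-*-assoc x b a)))

negligible-by-⌊log⌋ : ∀ {q u v w M} B (f : ℕ → ℕ) → 2 ≤ q → 1 ≤ w → 1 ≤ M → M ^ v < q ^ u * w ^ v →
  (∀ L a → q ^ L ≤ a → a < q ^ suc L → f a * w ^ L ≤ B * M ^ L) → Negligible u v f
negligible-by-⌊log⌋ {q} {u} {v} {w} {M} B f 2≤q 1≤w 1≤M Mᵛ<qᵘwᵛ bound = negligible λ e → q ^ (A e * X) , eventually e
  where
  A : ℕ → ℕ
  A e = (e * B) ^ v
  X : ℕ
  X = M ^ v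
  eventually : ∀ e a → q ^ (A e * X) ≤ a → (e * f a) ^ v < a ^ u
  eventually e a q^AX≤a = *-cancelʳ-< ((w ^ L) ^ v) _ _ (begin-strict
    (e * f a) ^ v * (w ^ L) ^ v         ≡⟨ ^-distribʳ-* (e * f a) (w ^ L) v ⟨
    (e * f a * w ^ L) ^ v               ≤⟨ ^-monoˡ-≤ v (subst (_≤ e * (B * M ^ L)) (sym (*-assoc e (f a) (w ^ L))) (*-monoʳ-≤ e (bound L a lo hi))) ⟩
    (e * (B * M ^ L)) ^ v               ≡⟨ trans (cong (_^ v) (sym (*-assoc e B (M ^ L)))) (^-distribʳ-* (e * B) (M ^ L) v) ⟩
    A e * (M ^ L) ^ v                   ≡⟨ cong (A e *_) (^-comm-exponents M L v) ⟩
    A e * X ^ L                         <⟨ A*X^L<Y^L (A e) L (m^n≥1 M v 1≤M) Mᵛ<qᵘwᵛ AX≤L ⟩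
    (q ^ u * w ^ v) ^ L                 ≡⟨ trans (^-distribʳ-* (q ^ u) (w ^ v) L) (cong₂ _*_ (^-comm-exponents q u L) (^-comm-exponents w v L)) ⟩
    (q ^ L) ^ u * (w ^ L) ^ v           ≤⟨ *-monoˡ-≤ _ (^-monoˡ-≤ u lo) ⟩
    a ^ u * (w ^ L) ^ v                 ∎)
    where
    open ≤-Reasoning
    log-a : ∃[ L ] (q ^ L ≤ a × a < q ^ suc L)
    log-a = ∃⌊log⌋ q a 2≤q (≤-trans (m^n≥1 q (A e * X) (≤-trans (s≤s z≤n) 2≤q)) q^AX≤a)
    L : ℕ
    L = proj₁ log-a
    lo : q ^ L ≤ a
    lo = proj₁ (proj₂ log-a)
    hi : a < q ^ suc L
    hi = proj₂ (proj₂ log-a)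
    AX≤L : A e * X ≤ L
    AX≤L = ≮⇒≥ λ L<AX → <⇒≱ hi (≤-trans (^-monoʳ-≤ q {{>-nonZero (≤-trans (s≤s z≤n) 2≤q)}} L<AX) q^AX≤a)

-- Congruences and valuations

infix 4 _≡1mod_
_≡1mod_ : ℕ → ℕ → Set
x ≡1mod Q = ∃[ t ] (x ≡ 1 + Q * t)

≡1mod-∣ : ∀ {x P Q} → P ∣ Q → x ≡1mod Q → x ≡1mod P
≡1mod-∣ {P = P} (divides k refl) (t , refl) = k * t , cong suc (regroup k P t)
  where
  regroup : ∀ k P t → k * P * t ≡ P * (k * t)
  regroup = solve-∀

≡1mod-^ : ∀ {x Q} → x ≡1mod Q → ∀ n → x ^ n ≡1mod Q
≡1mod-^ {Q = Q} _ zero = 0 , sym (cong suc (*-zeroʳ Q))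
≡1mod-^ {Q = Q} (t , refl) (suc n) with u , xⁿ≡ ← ≡1mod-^ {Q = Q} (t , refl) n =
  t + u + Q * t * u , trans (cong ((1 + Q * t) *_) xⁿ≡) (expand Q t u)
  where
  expand : ∀ Q t u → (1 + Q * t) * (1 + Q * u) ≡ 1 + Q * (t + u + Q * t * u)
  expand = solve-∀

[1+r]^n-expansion : ∀ r n → ∃[ S ] ((1 + r) ^ n ≡ 1 + r * (n + r * S))
[1+r]^n-expansion r zero = 0 , cong suc (sym (trans (cong (r *_) (*-zeroʳ r)) (*-zeroʳ r)))
[1+r]^n-expansion r (suc n) with S , eq ← [1+r]^n-expansion r n =
  S + n + r * S , trans (cong ((1 + r) *_) eq) (expand r n S)
  where
  expand : ∀ r n S → (1 + r) * (1 + r * (n + r * S)) ≡ 1 + r * (suc n + r * (S + n + r * S))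
  expand = solve-∀

2^s≡2^[s+d]⇒2^d≡1 : ∀ {Q} .{{_ : NonZero Q}} → (∀ s {X} → Q ∣ 2 ^ s * X → Q ∣ X) →
  ∀ s d → 2 ^ s % Q ≡ 2 ^ (s + d) % Q → 2 ^ d ≡1mod Q
2^s≡2^[s+d]⇒2^d≡1 {Q} cancel-2^s s d same-residue = quotient Q∣2^d-1 , (begin-equality
  2 ^ d                        ≡⟨ m∸n+n≡m {2 ^ d} {1} (m^n>0 2 d) ⟨
  2 ^ d ∸ 1 + 1                ≡⟨ +-comm (2 ^ d ∸ 1) 1 ⟩
  1 + (2 ^ d ∸ 1)              ≡⟨ cong suc (trans (m∣n⇒n≡quotient*m Q∣2^d-1) (*-comm _ Q)) ⟩
  1 + Q * quotient Q∣2^d-1     ∎)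
  where
  open ≤-Reasoning
  x y : ℕ
  x = 2 ^ s
  y = 2 ^ (s + d)
  y∸x≡[y/Q∸x/Q]*Q : y ∸ x ≡ (y / Q ∸ x / Q) * Q
  y∸x≡[y/Q∸x/Q]*Q = begin-equality
    y ∸ x                                        ≡⟨ cong₂ _∸_ (m≡m%n+[m/n]*n y Q) (m≡m%n+[m/n]*n x Q) ⟩
    (y % Q + y / Q * Q) ∸ (x % Q + x / Q * Q)    ≡⟨ cong (λ z → z + y / Q * Q ∸ (x % Q + x / Q * Q)) same-residue ⟨
    (x % Q + y / Q * Q) ∸ (x % Q + x / Q * Q)    ≡⟨ [m+n]∸[m+o]≡n∸o (x % Q) (y / Q * Q) (x / Q * Q) ⟩
    y / Q * Q ∸ x / Q * Q                        ≡⟨ *-distribʳ-∸ Q (y / Q) (x / Q) ⟨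
    (y / Q ∸ x / Q) * Q                          ∎
  y∸x≡x*[2^d∸1] : y ∸ x ≡ x * (2 ^ d ∸ 1)
  y∸x≡x*[2^d∸1] = begin-equality
    y ∸ x                  ≡⟨ cong₂ _∸_ (^-distribˡ-+-* 2 s d) (sym (*-identityʳ x)) ⟩
    x * 2 ^ d ∸ x * 1      ≡⟨ *-distribˡ-∸ x (2 ^ d) 1 ⟨
    x * (2 ^ d ∸ 1)        ∎
  Q∣2^d-1 : Q ∣ 2 ^ d ∸ 1
  Q∣2^d-1 = cancel-2^s s (divides (y / Q ∸ x / Q) (trans (sym y∸x≡x*[2^d∸1]) y∸x≡[y/Q∸x/Q]*Q))

module Valuation (q : ℕ) (q-prime : Prime q) where

  instance
    q≢0 : NonZero q
    q≢0 = prime⇒nonZero q-prime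

  1<q : 1 < q
  1<q = nonTrivial⇒n>1 q {{prime⇒nonTrivial q-prime}}

  q∤1 : ¬ q ∣ 1
  q∤1 q∣1 = <⇒≢ 1<q (sym (∣1⇒≡1 q∣1))

  record HasValuation (x e : ℕ) : Set where
    constructor valuation
    field
      unit : ℕ
      x≡qᵉ*unit : x ≡ q ^ e * unit
      q∤unit : ¬ q ∣ unit

  valuation-exists : ∀ x → 1 ≤ x → ∃[ e ] HasValuation x e
  valuation-exists = <-rec _ step
    where
    step : ∀ x → (∀ {y} → y < x → 1 ≤ y → ∃[ e ] HasValuation y e) → 1 ≤ x → ∃[ e ] HasValuation x e
    step x rec 1≤x with q ∣? x
    ... | no q∤x = 0 , valuation x (sym (+-identityʳ x)) q∤x
    ... | yes (divides y refl) = lift (rec (m<m*n y q {{>-nonZero 1≤y}} 1<q) 1≤y)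
      where
      1≤y : 1 ≤ y
      1≤y = n≢0⇒n>0 (λ { refl → contradiction 1≤x λ () })
      lift : ∃[ e ] HasValuation y e → ∃[ e ] HasValuation (y * q) e
      lift (e , valuation r y≡qᵉr q∤r) = suc e , valuation r (trans (cong (_* q) y≡qᵉr) (regroup (q ^ e) r q)) q∤r
        where
        regroup : ∀ a r q → a * r * q ≡ q * a * r
        regroup = solve-∀

  valuation-unique : ∀ {x e e′} → HasValuation x e → HasValuation x e′ → e ≡ e′
  valuation-unique {x} {zero} {zero} _ _ = refl
  valuation-unique {x} {zero} {suc e′} (valuation r refl q∤r) (valuation r′ eq′ _) =
    contradiction (divides (q ^ e′ * r′) (trans (sym (*-identityˡ r)) (trans eq′ (trans (*-assoc q (q ^ e′) r′) (*-comm q _))))) q∤r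
  valuation-unique {x} {suc e} {zero} (valuation r eq _) (valuation r′ refl q∤r′) =
    contradiction (divides (q ^ e * r) (trans (sym (*-identityˡ r′)) (trans eq (trans (*-assoc q (q ^ e) r) (*-comm q _))))) q∤r′
  valuation-unique {x} {suc e} {suc e′} (valuation r refl q∤r) (valuation r′ eq′ q∤r′) =
    cong suc (valuation-unique (valuation r refl q∤r) (valuation r′ cancel q∤r′))
    where
    cancel : q ^ e * r ≡ q ^ e′ * r′
    cancel = *-cancelˡ-≡ (q ^ e * r) (q ^ e′ * r′) q (trans (sym (*-assoc q (q ^ e) r)) (trans eq′ (*-assoc q (q ^ e′) r′)))

  valuation-* : ∀ {x y a b} → HasValuation x a → HasValuation y b → HasValuation (x * y) (a + b)
  valuation-* {a = a} {b} (valuation r refl q∤r) (valuation s refl q∤s) = valuation (r * s) regroup q∤rs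
    where
    regroup : q ^ a * r * (q ^ b * s) ≡ q ^ (a + b) * (r * s)
    regroup = trans (interchange (q ^ a) r (q ^ b) s) (cong (_* (r * s)) (sym (^-distribˡ-+-* q a b)))
      where
      interchange : ∀ a r b s → a * r * (b * s) ≡ a * b * (r * s)
      interchange = solve-∀
    q∤rs : ¬ q ∣ r * s
    q∤rs q∣rs with euclidsLemma r s q-prime q∣rs
    ... | inj₁ q∣r = q∤r q∣r
    ... | inj₂ q∣s = q∤s q∣s

  valuation⇒∣ : ∀ {x e} → HasValuation x e → q ^ e ∣ x
  valuation⇒∣ (valuation r refl _) = m∣m*n r

  valuation-1 : HasValuation 1 0
  valuation-1 = valuation 1 refl q∤1

  valuation-∤ : ∀ {x} → ¬ q ∣ x → HasValuation x 0
  valuation-∤ {x} q∤x = valuation x (sym (+-identityʳ x)) q∤x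

  valuation-q* : ∀ {y e} → HasValuation (q * y) e → ∃[ e′ ] (e ≡ suc e′ × HasValuation y e′)
  valuation-q* {y} {zero} (valuation r eq q∤r) = contradiction (divides y (trans (sym (+-identityʳ r)) (trans (sym eq) (*-comm q y)))) q∤r
  valuation-q* {y} {suc e} (valuation r eq q∤r) = e , refl , valuation r (*-cancelˡ-≡ y (q ^ e * r) q (trans eq (*-assoc q (q ^ e) r))) q∤r

-- A single odd prime

Bad : ℕ → ℕ → ℕ → Bool
Bad q K s = not (does (q ^ K ∣? centralBinom2 s))

module OddPrime (q h′ : ℕ) (q-prime : Prime q) (q≡1+2h′ : q ≡ suc (h′ + h′)) where

  open Valuation q q-prime public

  h : ℕ
  h = suc h′

  q≡h+h′ : q ≡ h + h′
  q≡h+h′ = q≡1+2h′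

  h+h≡1+q : h + h ≡ suc q
  h+h≡1+q = cong suc (trans (+-suc h′ h′) (sym q≡1+2h′))

  2<q : 2 < q
  2<q = subst (2 <_) (sym q≡1+2h′) (s≤s (+-mono-≤ 1≤h′ 1≤h′))
    where
    1≤h′ : 1 ≤ h′
    1≤h′ = n≢0⇒n>0 (λ h′≡0 → <⇒≢ 1<q (sym (trans q≡1+2h′ (cong (λ z → suc (z + z)) h′≡0))))

  n≡n%q+q*[n/q] : ∀ n → n ≡ n % q + q * (n / q)
  n≡n%q+q*[n/q] n = trans (m≡m%n+[m/n]*n n q) (cong (n % q +_) (*-comm (n / q) q))

  [r+q*N]/q≡N : ∀ {r} N → r < q → (r + q * N) / q ≡ N
  [r+q*N]/q≡N {r} N r<q = begin-equality
    (r + q * N) / q      ≡⟨ cong (λ z → (r + z) / q) (*-comm q N) ⟩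
    (r + N * q) / q      ≡⟨ +-distrib-/ r (N * q) (subst (_< q) (sym remainders) r<q) ⟩
    r / q + N * q / q    ≡⟨ cong₂ _+_ (m<n⇒m/n≡0 r<q) (m*n/n≡m N q) ⟩
    N                    ∎
    where
    open ≤-Reasoning
    remainders : r % q + N * q % q ≡ r
    remainders = trans (cong₂ _+_ (m<n⇒m%n≡m r<q) (m*n%n≡0 N q)) (+-identityʳ r)

  [r+q*N]%q≡r : ∀ {r} N → r < q → (r + q * N) % q ≡ r
  [r+q*N]%q≡r {r} N r<q = trans (cong (λ z → (r + z) % q) (*-comm q N)) (trans ([m+kn]%n≡m%n r N q) (m<n⇒m%n≡m r<q))

  q*t≤n⇒t≤n/q : ∀ {t n} → q * t ≤ n → t ≤ n / q
  q*t≤n⇒t≤n/q {t} {n} qt≤n = subst (_≤ n / q) (trans (cong (_/ q) (*-comm q t)) (m*n/n≡m t q)) (/-monoˡ-≤ q qt≤n)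

  n/q<n : ∀ n → 1 ≤ n → n / q < n
  n/q<n (suc n) _ = m/n<m (suc n) q 1<q

  -- legendreFuel f n = ∑_{1 ≤ i ≤ f} ⌊n / q^i⌋; fuel f = n suffices since the terms vanish for q^i > n.
  legendreFuel : ℕ → ℕ → ℕ
  legendreFuel zero n = 0
  legendreFuel (suc f) n = n / q + legendreFuel f (n / q)

  legendre : ℕ → ℕ
  legendre n = legendreFuel n n

  legendreFuel-suc : ∀ f n → n ≤ f → legendreFuel (suc f) n ≡ legendreFuel f n
  legendreFuel-suc zero zero _ = trans (+-identityʳ _) (0/n≡0 q)
  legendreFuel-suc (suc f) zero _ = cong (0 / q +_) (legendreFuel-suc f (0 / q) (subst (_≤ f) (sym (0/n≡0 q)) z≤n))
  legendreFuel-suc (suc f) (suc n) n<1+f =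
    cong (suc n / q +_) (legendreFuel-suc f (suc n / q) (≤-pred (≤-trans (n/q<n (suc n) (s≤s z≤n)) n<1+f)))

  legendreFuel-enough : ∀ f n → n ≤ f → legendreFuel f n ≡ legendre n
  legendreFuel-enough f n n≤f with d , refl ← m≤n⇒∃[o]m+o≡n n≤f = extra d
    where
    extra : ∀ d → legendreFuel (n + d) n ≡ legendre n
    extra zero = cong (λ f → legendreFuel f n) (+-identityʳ n)
    extra (suc d) = trans (cong (λ f → legendreFuel f n) (+-suc n d)) (trans (legendreFuel-suc (n + d) n (m≤m+n n d)) (extra d))

  legendre-unfold : ∀ n → legendre n ≡ n / q + legendre (n / q)
  legendre-unfold zero = sym (cong (λ z → z + legendre z) (0/n≡0 q))
  legendre-unfold (suc n) = cong (suc n / q +_) (legendreFuel-enough n (suc n / q) (≤-pred (n/q<n (suc n) (s≤s z≤n))))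

  legendre-mono : ∀ {m n} → m ≤ n → legendre m ≤ legendre n
  legendre-mono {n = n} = <-rec (λ n → ∀ {m} → m ≤ n → legendre m ≤ legendre n) step n
    where
    step : ∀ n → (∀ {n′} → n′ < n → ∀ {m} → m ≤ n′ → legendre m ≤ legendre n′) →
           ∀ {m} → m ≤ n → legendre m ≤ legendre n
    step n rec {zero} _ = z≤n
    step (suc n) rec {suc m} m≤n = begin
      legendre (suc m)                        ≡⟨ legendre-unfold (suc m) ⟩
      suc m / q + legendre (suc m / q)        ≤⟨ +-mono-≤ m/q≤n/q (rec (n/q<n (suc n) (s≤s z≤n)) m/q≤n/q) ⟩
      suc n / q + legendre (suc n / q)        ≡⟨ legendre-unfold (suc n) ⟨
      legendre (suc n)                        ∎
      where
      open ≤-Reasoning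
      m/q≤n/q : suc m / q ≤ suc n / q
      m/q≤n/q = /-monoˡ-≤ q m≤n

  legendre-suc : ∀ x {e} → HasValuation (suc x) e → legendre (suc x) ≡ legendre x + e
  legendre-suc = <-rec _ step
    where
    step : ∀ x → (∀ {y} → y < x → ∀ {e} → HasValuation (suc y) e → legendre (suc y) ≡ legendre y + e) →
           ∀ {e} → HasValuation (suc x) e → legendre (suc x) ≡ legendre x + e
    step x rec {e} ν with x % q | x / q | n≡n%q+q*[n/q] x | m%n<n x q | suc (x % q) ≟ q
    ... | r | N | x≡r+qN | r<q | yes 1+r≡q = begin
      legendre (suc x)                    ≡⟨ legendre-unfold (suc x) ⟩
      suc x / q + legendre (suc x / q)    ≡⟨ cong (λ z → z + legendre z) [1+x]/q≡1+N ⟩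
      suc N + legendre (suc N)            ≡⟨ cong (suc N +_) (rec N<x ν′) ⟩
      suc N + (legendre N + e′)           ≡⟨ regroup N (legendre N) e′ ⟩
      (N + legendre N) + suc e′           ≡⟨ cong₂ _+_ (cong (λ z → z + legendre z) x/q≡N) e≡1+e′ ⟨
      x / q + legendre (x / q) + e        ≡⟨ cong (_+ e) (legendre-unfold x) ⟨
      legendre x + e                      ∎
      where
      open ≡-Reasoning
      1+x≡q[1+N] : suc x ≡ q * suc N
      1+x≡q[1+N] = trans (cong suc x≡r+qN) (trans (cong (_+ q * N) 1+r≡q) (sym (*-suc q N)))
      [1+x]/q≡1+N : suc x / q ≡ suc N
      [1+x]/q≡1+N = trans (cong (_/ q) 1+x≡q[1+N]) ([r+q*N]/q≡N (suc N) (≤-trans (s≤s z≤n) 1<q))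
      x/q≡N : x / q ≡ N
      x/q≡N = trans (cong (_/ q) x≡r+qN) ([r+q*N]/q≡N N r<q)
      N<x : N < x
      N<x = subst (_< x) x/q≡N (n/q<n x 1≤x)
        where
        1≤x : 1 ≤ x
        1≤x = n≢0⇒n>0 λ x≡0 → <⇒≢ 1<q (sym (trans (sym 1+r≡q) (cong suc (m+n≡0⇒m≡0 r (trans (sym x≡r+qN) x≡0)))))
      decomposition : ∃[ e′ ] (e ≡ suc e′ × HasValuation (suc N) e′)
      decomposition = valuation-q* (subst (λ z → HasValuation z e) 1+x≡q[1+N] ν)
      e′ : ℕ
      e′ = proj₁ decomposition
      e≡1+e′ : e ≡ suc e′
      e≡1+e′ = proj₁ (proj₂ decomposition)
      ν′ : HasValuation (suc N) e′
      ν′ = proj₂ (proj₂ decomposition)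
      regroup : ∀ a b c → suc a + (b + c) ≡ (a + b) + suc c
      regroup = solve-∀
    ... | r | N | x≡r+qN | r<q | no 1+r≢q = begin
      legendre (suc x)                    ≡⟨ legendre-unfold (suc x) ⟩
      suc x / q + legendre (suc x / q)    ≡⟨ cong (λ z → z + legendre z) (trans [1+x]/q≡N (sym x/q≡N)) ⟩
      x / q + legendre (x / q)            ≡⟨ legendre-unfold x ⟨
      legendre x                          ≡⟨ +-identityʳ (legendre x) ⟨
      legendre x + 0                      ≡⟨ cong (legendre x +_) (valuation-unique (valuation-∤ q∤1+x) ν) ⟩
      legendre x + e                      ∎
      where
      open ≡-Reasoning
      1+r<q : suc r < q
      1+r<q = ≤∧≢⇒< r<q 1+r≢q
      [1+x]/q≡N : suc x / q ≡ N
      [1+x]/q≡N = trans (cong (λ z → suc z / q) x≡r+qN) ([r+q*N]/q≡N N 1+r<q)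
      x/q≡N : x / q ≡ N
      x/q≡N = trans (cong (_/ q) x≡r+qN) ([r+q*N]/q≡N N r<q)
      q∤1+x : ¬ q ∣ suc x
      q∤1+x q∣1+x = contradiction
        (trans (sym ([r+q*N]%q≡r N 1+r<q)) (trans (cong (λ z → suc z % q) (sym x≡r+qN)) (n∣m⇒m%n≡0 (suc x) q q∣1+x))) λ ()

  valuation-! : ∀ n → HasValuation (n !) (legendre n)
  valuation-! zero = valuation-1
  valuation-! (suc n) with e , ν ← valuation-exists (suc n) (s≤s z≤n) =
    subst (HasValuation (suc n !)) (trans (+-comm e (legendre n)) (sym (legendre-suc n ν))) (valuation-* ν (valuation-! n))

  isBig : ℕ → ℕ
  isBig r = fromBool (h ≤ᵇ r)

  isBig-≥ : ∀ {r} → h ≤ r → isBig r ≡ 1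
  isBig-≥ {r} h≤r with h ≤ᵇ r | ≤⇒≤ᵇ h≤r
  ... | true | _ = refl

  isBig-< : ∀ {r} → r < h → isBig r ≡ 0
  isBig-< {r} r<h with h ≤ᵇ r in h≤ᵇr
  ... | false = refl
  ... | true = contradiction (≤ᵇ⇒≤ h r (subst T (sym h≤ᵇr) _)) (<⇒≱ r<h)

  bigDigits : ℕ → ℕ → ℕ
  bigDigits zero n = 0
  bigDigits (suc J) n = isBig (n % q) + bigDigits J (n / q)

  bigDigits-0 : ∀ J → bigDigits J 0 ≡ 0
  bigDigits-0 zero = refl
  bigDigits-0 (suc J) = trans (cong₂ (λ r n → isBig r + bigDigits J n) (m<n⇒m%n≡m (>-nonZero⁻¹ q)) (0/n≡0 q)) (bigDigits-0 J)

  n+n≡[r+r]+q*[N+N] : ∀ n → n + n ≡ (n % q + n % q) + q * (n / q + n / q)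
  n+n≡[r+r]+q*[N+N] n = trans (cong₂ _+_ (n≡n%q+q*[n/q] n) (n≡n%q+q*[n/q] n)) (regroup (n % q) q (n / q))
    where
    regroup : ∀ r q N → (r + q * N) + (r + q * N) ≡ (r + r) + q * (N + N)
    regroup = solve-∀

  -- A digit ≥ h = (q+1)/2 overflows when doubled.
  doubling-carry : ∀ n → n / q + n / q + isBig (n % q) ≤ (n + n) / q
  doubling-carry n with h ≤? n % q
  ... | no h≰r = subst (_≤ (n + n) / q) (trans (sym (+-identityʳ _)) (cong (_ +_) (sym (isBig-< (≰⇒> h≰r)))))
          (q*t≤n⇒t≤n/q (subst (q * (n / q + n / q) ≤_) (sym (n+n≡[r+r]+q*[N+N] n)) (m≤n+m _ (n % q + n % q))))
  ... | yes h≤r = subst (_≤ (n + n) / q) (trans (+-comm 1 _) (cong (_ +_) (sym (isBig-≥ h≤r)))) (q*t≤n⇒t≤n/q (begin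
      q * suc (n / q + n / q)                    ≡⟨ *-suc q _ ⟩
      q + q * (n / q + n / q)                    ≤⟨ +-monoˡ-≤ _ (≤-trans (n≤1+n q) (subst (_≤ n % q + n % q) h+h≡1+q (+-mono-≤ h≤r h≤r))) ⟩
      (n % q + n % q) + q * (n / q + n / q)      ≡⟨ n+n≡[r+r]+q*[N+N] n ⟨
      n + n                                      ∎))
    where open ≤-Reasoning

  legendre-double : ∀ J n → legendre n + legendre n + bigDigits J n ≤ legendre (n + n)
  legendre-double J n = <-rec (λ n → ∀ J → legendre n + legendre n + bigDigits J n ≤ legendre (n + n)) step n J
    where
    step : ∀ n → (∀ {n′} → n′ < n → ∀ J → legendre n′ + legendre n′ + bigDigits J n′ ≤ legendre (n′ + n′)) →
           ∀ J → legendre n + legendre n + bigDigits J n ≤ legendre (n + n)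
    step zero _ J = subst (_≤ 0) (sym (bigDigits-0 J)) z≤n
    step n@(suc _) rec J = begin
      legendre n + legendre n + bigDigits J n                  ≡⟨ cong (λ z → z + z + bigDigits J n) (legendre-unfold n) ⟩
      (N + legendre N) + (N + legendre N) + bigDigits J n      ≤⟨ digits J ⟩
      (N + N + isBig (n % q)) + (legendre N + legendre N + bigDigits (pred J) N) ≤⟨ +-monoʳ-≤ (N + N + isBig (n % q)) (rec (n/q<n n (s≤s z≤n)) (pred J)) ⟩
      (N + N + isBig (n % q)) + legendre (N + N)               ≤⟨ +-mono-≤ (doubling-carry n) (legendre-mono (≤-trans (m≤m+n (N + N) _) (doubling-carry n))) ⟩
      (n + n) / q + legendre ((n + n) / q)                     ≡⟨ legendre-unfold (n + n) ⟨
      legendre (n + n)                                         ∎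
      where
      open ≤-Reasoning
      N : ℕ
      N = n / q
      digits : ∀ J → (N + legendre N) + (N + legendre N) + bigDigits J n ≤ (N + N + isBig (n % q)) + (legendre N + legendre N + bigDigits (pred J) N)
      digits zero = subst (_≤ (N + N + isBig (n % q)) + (legendre N + legendre N + 0)) (regroup₀ N (legendre N))
        (+-mono-≤ (m≤m+n (N + N) _) (m≤m+n (legendre N + legendre N) _))
        where
        regroup₀ : ∀ a b → a + a + (b + b) ≡ (a + b) + (a + b) + 0
        regroup₀ = solve-∀
      digits (suc J) = ≤-reflexive (regroup N (legendre N) (isBig (n % q)) (bigDigits J N))
        where
        regroup : ∀ a b c d → (a + b) + (a + b) + (c + d) ≡ (a + a + c) + (b + b + d)
        regroup = solve-∀

  central-binomial-factorials : ∀ n → ((n + n) C n) * (n ! * n !) ≡ (n + n) !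
  central-binomial-factorials n = begin-equality
    ((n + n) C n) * (n ! * n !)                             ≡⟨ cong (λ z → ((n + n) C n) * (n ! * z !)) (m+n∸n≡m n n) ⟨
    ((n + n) C n) * (n ! * (n + n ∸ n) !)                   ≡⟨ cong (_* (n ! * (n + n ∸ n) !)) (nCk≡n!/k![n-k]! (m≤m+n n n)) ⟩
    ((n + n) ! / (n ! * (n + n ∸ n) !)) * (n ! * (n + n ∸ n) !) ≡⟨ m/n*n≡m (k![n∸k]!∣n! (m≤m+n n n)) ⟩
    (n + n) !                                             ∎
    where
    open ≤-Reasoning
    instance
      _ : NonZero (n ! * (n + n ∸ n) !)
      _ = n !* (n + n ∸ n) !≢0

  q^bigDigits∣central-binomial : ∀ J n → q ^ bigDigits J n ∣ (n + n) C n
  q^bigDigits∣central-binomial J n = ∣-trans (^-monoʳ-∣ q bigDigits≤c) (valuation⇒∣ ν)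
    where
    1≤C : 1 ≤ (n + n) C n
    1≤C = n≢0⇒n>0 λ C≡0 → ≢-nonZero⁻¹ ((n + n) !) {{(n + n) !≢0}}
      (trans (sym (central-binomial-factorials n)) (cong (_* (n ! * n !)) C≡0))
    c : ℕ
    c = proj₁ (valuation-exists ((n + n) C n) 1≤C)
    ν : HasValuation ((n + n) C n) c
    ν = proj₂ (valuation-exists ((n + n) C n) 1≤C)
    c+2legendre≡ : c + (legendre n + legendre n) ≡ legendre (n + n)
    c+2legendre≡ = valuation-unique
      (subst (λ z → HasValuation z (c + (legendre n + legendre n))) (central-binomial-factorials n)
        (valuation-* ν (valuation-* (valuation-! n) (valuation-! n))))
      (valuation-! (n + n))
    bigDigits≤c : bigDigits J n ≤ c
    bigDigits≤c = +-cancelˡ-≤ (legendre n + legendre n) _ _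
      (subst (legendre n + legendre n + bigDigits J n ≤_) (trans (sym c+2legendre≡) (+-comm c _)) (legendre-double J n))

  fewBig : ℕ → ℕ → ℕ → Bool
  fewBig J K r = bigDigits J r <ᵇ K

  countFewBig : ℕ → ℕ → ℕ
  countFewBig J K = count (fewBig J K) (q ^ J)

  bigDigits-digit : ∀ J i {j} → j < q → bigDigits (suc J) (i * q + j) ≡ isBig j + bigDigits J i
  bigDigits-digit J i {j} j<q = cong₂ (λ r n → isBig r + bigDigits J n) (trans (cong (_% q) iq+j≡) ([r+q*N]%q≡r i j<q))
                                                                      (trans (cong (_/ q) iq+j≡) ([r+q*N]/q≡N i j<q))
    where
    iq+j≡ : i * q + j ≡ j + q * i
    iq+j≡ = trans (+-comm (i * q) j) (cong (j +_) (*-comm i q))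

  countFewBig-suc : ∀ J K → countFewBig (suc J) (suc K) ≤ h * countFewBig J (suc K) + h * countFewBig J K
  countFewBig-suc J K = begin
    countFewBig (suc J) (suc K)                              ≡⟨ cong (count (fewBig (suc J) (suc K))) (*-comm q (q ^ J)) ⟩
    ∑ (fromBool ∘ fewBig (suc J) (suc K)) (q ^ J * q)        ≡⟨ ∑-block _ (q ^ J) q ⟩
    ∑ (λ i → ∑ (f i) q) (q ^ J)                              ≤⟨ ∑-mono-≤ (q ^ J) (λ i _ → by-last-digit i) ⟩
    ∑ (λ i → h * a i + h * b i) (q ^ J)                      ≡⟨ ∑-+ _ _ (q ^ J) ⟩
    ∑ (λ i → h * a i) (q ^ J) + ∑ (λ i → h * b i) (q ^ J)    ≡⟨ cong₂ _+_ (∑-*ˡ h a (q ^ J)) (∑-*ˡ h b (q ^ J)) ⟩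
    h * countFewBig J (suc K) + h * countFewBig J K          ∎
    where
    open ≤-Reasoning
    a b : ℕ → ℕ
    a i = fromBool (fewBig J (suc K) i)
    b i = fromBool (fewBig J K i)
    f : ℕ → ℕ → ℕ
    f i j = fromBool (fewBig (suc J) (suc K) (i * q + j))
    small-digit : ∀ i j → j < h → f i j ≡ a i
    small-digit i j j<h = cong (λ z → fromBool (z <ᵇ suc K))
      (trans (bigDigits-digit J i (≤-trans j<h (subst (h ≤_) (sym q≡h+h′) (m≤m+n h h′)))) (cong (_+ bigDigits J i) (isBig-< j<h)))
    big-digit : ∀ i j → j < h′ → f i (h + j) ≡ b i
    big-digit i j j<h′ = cong (λ z → fromBool (z <ᵇ suc K))
      (trans (bigDigits-digit J i (subst (h + j <_) (sym q≡h+h′) (+-monoʳ-< h j<h′))) (cong (_+ bigDigits J i) (isBig-≥ (m≤m+n h j))))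
    by-last-digit : ∀ i → ∑ (f i) q ≤ h * a i + h * b i
    by-last-digit i = begin
      ∑ (f i) q                                 ≡⟨ cong (∑ (f i)) q≡h+h′ ⟩
      ∑ (f i) (h + h′)                          ≡⟨ ∑-split (f i) h h′ ⟩
      ∑ (f i) h + ∑ (λ j → f i (h + j)) h′      ≡⟨ cong₂ _+_ (∑-cong h (small-digit i)) (∑-cong h′ (big-digit i)) ⟩
      ∑ (λ _ → a i) h + ∑ (λ _ → b i) h′        ≡⟨ cong₂ _+_ (∑-const (a i) h) (∑-const (b i) h′) ⟩
      h * a i + h′ * b i                        ≤⟨ +-monoʳ-≤ (h * a i) (*-monoˡ-≤ (b i) (n≤1+n h′)) ⟩
      h * a i + h * b i                         ∎

  countFewBig-0 : ∀ J → countFewBig (suc J) 0 ≡ 0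
  countFewBig-0 J = ∑-zero (q ^ suc J)

  -- Rankin's trick: a residue with fewer than K big digits has weight w ^ (K - bigDigits J r) ≥ 1,
  -- and the weights w ^ (- bigDigits J r) of all r < q ^ J sum to (h + h′ / w) ^ J ≤ (h (1 + 1/w)) ^ J.
  countFewBig-bound : ∀ w → 1 ≤ w → ∀ J K → countFewBig J K * w ^ J ≤ w ^ K * (h * (w + 1)) ^ J
  countFewBig-bound w 1≤w zero zero = z≤n
  countFewBig-bound w 1≤w zero (suc K) = *-monoˡ-≤ 1 (^-monoʳ-≤ w {{>-nonZero 1≤w}} {0} {suc K} z≤n)
  countFewBig-bound w 1≤w (suc J) zero = subst (λ z → z * w ^ suc J ≤ w ^ 0 * (h * (w + 1)) ^ suc J) (sym (countFewBig-0 J)) z≤n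
  countFewBig-bound w 1≤w (suc J) (suc K) = begin
    countFewBig (suc J) (suc K) * w ^ suc J    ≤⟨ *-monoˡ-≤ (w ^ suc J) (countFewBig-suc J K) ⟩
    (h * A + h * B) * (w * w ^ J)              ≡⟨ regroup₁ h A B w (w ^ J) ⟩
    h * w * (A * w ^ J) + h * w * (B * w ^ J)  ≤⟨ +-mono-≤ (*-monoʳ-≤ (h * w) (countFewBig-bound w 1≤w J (suc K)))
                                                           (*-monoʳ-≤ (h * w) (countFewBig-bound w 1≤w J K)) ⟩
    h * w * (w * w ^ K * M ^ J) + h * w * (w ^ K * M ^ J) ≡⟨ regroup₂ h w (w ^ K) (M ^ J) ⟩
    w * w ^ K * (h * (w + 1) * M ^ J)          ∎
    where
    open ≤-Reasoning
    A B M : ℕ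
    A = countFewBig J (suc K)
    B = countFewBig J K
    M = h * (w + 1)
    regroup₁ : ∀ h A B w x → (h * A + h * B) * (w * x) ≡ h * w * (A * x) + h * w * (B * x)
    regroup₁ = solve-∀
    regroup₂ : ∀ h w x y → h * w * (w * x * y) + h * w * (x * y) ≡ w * x * (h * (w + 1) * y)
    regroup₂ = solve-∀

  q∤2 : ¬ q ∣ 2
  q∤2 q∣2 = <⇒≱ 2<q (∣⇒≤ q∣2)

  q^n∣2^s*X⇒q^n∣X : ∀ n s {X} → q ^ n ∣ 2 ^ s * X → q ^ n ∣ X
  q^n∣2^s*X⇒q^n∣X n zero {X} q^n∣X = subst (q ^ n ∣_) (+-identityʳ X) q^n∣X
  q^n∣2^s*X⇒q^n∣X n (suc s) {X} q^n∣2^[1+s]X =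
    q^n∣2^s*X⇒q^n∣X n s (prime^-cancelˡ-∣ q-prime q∤2 n (2 ^ s * X) (subst (q ^ n ∣_) (*-assoc 2 (2 ^ s) X) q^n∣2^[1+s]X))

  2^i%q^n : ∀ n → Fin (suc (q ^ n)) → Fin (q ^ n)
  2^i%q^n n i = fromℕ< (m%n<n (2 ^ toℕ i) (q ^ n) {{m^n≢0 q n}})

  ∃2^d≡1 : ∀ n → ∃[ d ] (1 ≤ d × 2 ^ d ≡1mod q ^ n)
  ∃2^d≡1 n = from-collision (pigeonhole (n<1+n (q ^ n)) (2^i%q^n n))
    where
    instance
      q^n≢0 : NonZero (q ^ n)
      q^n≢0 = m^n≢0 q n
    from-collision : ∃[ i ] ∃[ j ] (i <ᶠ j × 2^i%q^n n i ≡ 2^i%q^n n j) → ∃[ d ] (1 ≤ d × 2 ^ d ≡1mod q ^ n)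
    from-collision (i , j , i<j , collision) =
      toℕ j ∸ toℕ i , m<n⇒0<n∸m i<j , 2^s≡2^[s+d]⇒2^d≡1 (q^n∣2^s*X⇒q^n∣X n) (toℕ i) (toℕ j ∸ toℕ i) (begin-equality
        2 ^ toℕ i % q ^ n                        ≡⟨ toℕ-fromℕ< (m%n<n (2 ^ toℕ i) (q ^ n)) ⟨
        toℕ (2^i%q^n n i)                        ≡⟨ cong toℕ collision ⟩
        toℕ (2^i%q^n n j)                        ≡⟨ toℕ-fromℕ< (m%n<n (2 ^ toℕ j) (q ^ n)) ⟩
        2 ^ toℕ j % q ^ n                        ≡⟨ cong (λ z → 2 ^ z % q ^ n) (m+[n∸m]≡n (<⇒≤ i<j)) ⟨
        2 ^ (toℕ i + (toℕ j ∸ toℕ i)) % q ^ n    ∎)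
      where open ≤-Reasoning

  -- Starting from 2 ^ t₀ ≡ 1 modulo q² rather than q gives the exponent 2 + c ≥ 2 that lift needs.
  -- Opaque, so that the type checker never unfolds the pigeonhole search behind the witness.
  opaque
    ∃2^t₀≡1+q^[2+c]*b : ∃[ t₀ ] ∃[ c ] ∃[ b ] (2 ^ t₀ ≡ 1 + q ^ (2 + c) * b × ¬ q ∣ b)
    ∃2^t₀≡1+q^[2+c]*b = from-q² (∃2^d≡1 2)
      where
      from-q² : ∃[ d ] (1 ≤ d × 2 ^ d ≡1mod q ^ 2) → ∃[ t₀ ] ∃[ c ] ∃[ b ] (2 ^ t₀ ≡ 1 + q ^ (2 + c) * b × ¬ q ∣ b)
      from-q² (t₀ , 1≤t₀ , t , 2^t₀≡1+q²t) = t₀ , c , unit , 2^t₀≡ , q∤unit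
        where
        1≤t : 1 ≤ t
        1≤t = n≢0⇒n>0 λ t≡0 → contradiction (subst (2 ^ 1 ≤_) (2^t₀≡1 t≡0) (^-monoʳ-≤ 2 1≤t₀)) λ { (s≤s ()) }
          where
          2^t₀≡1 : t ≡ 0 → 2 ^ t₀ ≡ 1
          2^t₀≡1 t≡0 = trans 2^t₀≡1+q²t (trans (cong (λ z → 1 + q ^ 2 * z) t≡0) (cong suc (*-zeroʳ (q ^ 2))))
        c : ℕ
        c = proj₁ (valuation-exists t 1≤t)
        open HasValuation (proj₂ (valuation-exists t 1≤t))
        2^t₀≡ : 2 ^ t₀ ≡ 1 + q ^ (2 + c) * unit
        2^t₀≡ = begin-equality
          2 ^ t₀                      ≡⟨ 2^t₀≡1+q²t ⟩
          1 + q ^ 2 * t               ≡⟨ cong (λ z → 1 + q ^ 2 * z) x≡qᵉ*unit ⟩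
          1 + q ^ 2 * (q ^ c * unit)  ≡⟨ cong suc (*-assoc (q ^ 2) (q ^ c) unit) ⟨
          1 + q ^ 2 * q ^ c * unit    ≡⟨ cong (λ z → 1 + z * unit) (^-distribˡ-+-* q 2 c) ⟨
          1 + q ^ (2 + c) * unit      ∎
          where open ≤-Reasoning

  -- (1 + r) ^ m ≡ 1 + m r modulo r², and r = q ^ (1 + k) b has valuation exactly 1 + k.
  q∣exponent : ∀ k {b m} → ¬ q ∣ b → (1 + q ^ suc k * b) ^ m ≡1mod q ^ suc (suc k) → q ∣ m
  q∣exponent k {b} {m} q∤b (K , [1+r]^m≡) = q∣m
    where
    P r S : ℕ
    P = q ^ suc k
    r = P * b
    S = proj₁ ([1+r]^n-expansion r m)
    b[m+rS]≡qK : b * (m + r * S) ≡ q * K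
    b[m+rS]≡qK = *-cancelˡ-≡ _ _ P {{m^n≢0 q (suc k)}} (begin-equality
      P * (b * (m + r * S))     ≡⟨ *-assoc P b _ ⟨
      r * (m + r * S)           ≡⟨ suc-injective (trans (sym (proj₂ ([1+r]^n-expansion r m))) [1+r]^m≡) ⟩
      q * P * K                 ≡⟨ regroup q P K ⟩
      P * (q * K)               ∎)
      where
      open ≤-Reasoning
      regroup : ∀ q P K → q * P * K ≡ P * (q * K)
      regroup = solve-∀
    q∣m : q ∣ m
    q∣m with euclidsLemma b (m + r * S) q-prime (divides K (trans b[m+rS]≡qK (*-comm q K)))
    ... | inj₁ q∣b = contradiction q∣b q∤b
    ... | inj₂ q∣m+rS = ∣m+n∣m⇒∣n (subst (q ∣_) (+-comm m (r * S)) q∣m+rS) (∣-trans (∣-trans (m∣m*n (q ^ k)) (m∣m*n b)) (m∣m*n S))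

  -- Once q² ∣ r, raising 1 + r to the power q multiplies r by exactly one more factor q.
  lift : ∀ j {b} → ¬ q ∣ b → ∃[ b′ ] ((1 + q ^ (2 + j) * b) ^ q ≡ 1 + q ^ (3 + j) * b′ × ¬ q ∣ b′)
  lift j {b} q∤b = b * (1 + q * (q ^ j * b * S)) , (begin-equality
    (1 + r) ^ q                                     ≡⟨ proj₂ ([1+r]^n-expansion r q) ⟩
    1 + r * (q + r * S)                             ≡⟨ cong suc (regroup q (q ^ j) b S) ⟩
    1 + q ^ (3 + j) * (b * (1 + q * (q ^ j * b * S))) ∎) , q∤b′
    where
    open ≤-Reasoning
    r S : ℕ
    r = q ^ (2 + j) * b
    S = proj₁ ([1+r]^n-expansion r q)
    regroup : ∀ q Qj b S → q * (q * Qj) * b * (q + q * (q * Qj) * b * S) ≡ q * (q * (q * Qj)) * (b * (1 + q * (Qj * b * S)))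
    regroup = solve-∀
    q∤b′ : ¬ q ∣ b * (1 + q * (q ^ j * b * S))
    q∤b′ q∣b′ with euclidsLemma b _ q-prime q∣b′
    ... | inj₁ q∣b = q∤b q∣b
    ... | inj₂ q∣1+qX = q∤1 (∣m+n∣m⇒∣n (subst (q ∣_) (+-comm 1 _) q∣1+qX) (m∣m*n _))

  module _ {t₀ c b : ℕ} (2^t₀≡ : 2 ^ t₀ ≡ 1 + q ^ (2 + c) * b) (q∤b : ¬ q ∣ b) where

    2^[t₀*q^i] : ∀ i → ∃[ bᵢ ] (2 ^ (t₀ * q ^ i) ≡ 1 + q ^ (2 + c + i) * bᵢ × ¬ q ∣ bᵢ)
    2^[t₀*q^i] zero = b , trans (cong (2 ^_) (*-identityʳ t₀)) (trans 2^t₀≡ (cong (λ z → 1 + q ^ z * b) (sym (+-identityʳ (2 + c))))) , q∤b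
    2^[t₀*q^i] (suc i) = lift-step (2^[t₀*q^i] i)
      where
      lift-step : ∃[ bᵢ ] (2 ^ (t₀ * q ^ i) ≡ 1 + q ^ (2 + c + i) * bᵢ × ¬ q ∣ bᵢ) →
                  ∃[ b′ ] (2 ^ (t₀ * q ^ suc i) ≡ 1 + q ^ (2 + c + suc i) * b′ × ¬ q ∣ b′)
      lift-step (bᵢ , 2^[t₀q^i]≡ , q∤bᵢ) with b′ , lifted , q∤b′ ← lift (c + i) q∤bᵢ = b′ , (begin-equality
        2 ^ (t₀ * q ^ suc i)                ≡⟨ cong (2 ^_) (regroup t₀ q (q ^ i)) ⟩
        2 ^ (t₀ * q ^ i * q)                ≡⟨ ^-*-assoc 2 (t₀ * q ^ i) q ⟨
        (2 ^ (t₀ * q ^ i)) ^ q              ≡⟨ cong (_^ q) 2^[t₀q^i]≡ ⟩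
        (1 + q ^ (2 + c + i) * bᵢ) ^ q      ≡⟨ lifted ⟩
        1 + q ^ (3 + (c + i)) * b′          ≡⟨ cong (λ z → 1 + q ^ (2 + z) * b′) (+-suc c i) ⟨
        1 + q ^ (2 + c + suc i) * b′        ∎) , q∤b′
        where
        open ≤-Reasoning
        regroup : ∀ a b c → a * (b * c) ≡ a * c * b
        regroup = solve-∀

    q^i∣order : ∀ i {t} → 2 ^ t ≡1mod q ^ (2 + c + i) → q ^ i ∣ t
    q^i∣order zero {t} _ = 1∣ t
    q^i∣order (suc i) {t} (K , 2^t≡) =
      from-q^i (q^i∣order i (≡1mod-∣ {Q = q ^ (3 + (c + i))} (^-monoʳ-∣ q {2 + c + i} (n≤1+n _)) (K , 2^t≡′)))
      where
      2^t≡′ : 2 ^ t ≡ 1 + q ^ (3 + (c + i)) * K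
      2^t≡′ = trans 2^t≡ (cong (λ z → 1 + q ^ (2 + z) * K) (+-suc c i))
      from-q^i : q ^ i ∣ t → q ^ suc i ∣ t
      from-q^i (divides k t≡kq^i) = from-q∣k (q∣exponent (suc (c + i)) q∤bᵢ [1+qᵏbᵢ]^k≡1)
        where
        from-q∣k : q ∣ k → q ^ suc i ∣ t
        from-q∣k (divides k′ refl) = divides k′ (trans t≡kq^i (*-assoc k′ q (q ^ i)))
        bᵢ : ℕ
        bᵢ = proj₁ (2^[t₀*q^i] i)
        q∤bᵢ : ¬ q ∣ bᵢ
        q∤bᵢ = proj₂ (proj₂ (2^[t₀*q^i] i))
        [1+qᵏbᵢ]^k≡1 : (1 + q ^ (2 + c + i) * bᵢ) ^ k ≡1mod q ^ (3 + (c + i))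
        [1+qᵏbᵢ]^k≡1 = subst (_≡1mod q ^ (3 + (c + i))) (begin-equality
          (2 ^ t) ^ t₀                     ≡⟨ ^-*-assoc 2 t t₀ ⟩
          2 ^ (t * t₀)                     ≡⟨ cong (λ z → 2 ^ (z * t₀)) t≡kq^i ⟩
          2 ^ (k * q ^ i * t₀)             ≡⟨ cong (2 ^_) (regroup k (q ^ i) t₀) ⟩
          2 ^ (t₀ * q ^ i * k)             ≡⟨ ^-*-assoc 2 (t₀ * q ^ i) k ⟨
          (2 ^ (t₀ * q ^ i)) ^ k           ≡⟨ cong (_^ k) (proj₁ (proj₂ (2^[t₀*q^i] i))) ⟩
          (1 + q ^ (2 + c + i) * bᵢ) ^ k   ∎) (≡1mod-^ {Q = q ^ (3 + (c + i))} (K , 2^t≡′) t₀)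
          where
          open ≤-Reasoning
          regroup : ∀ k Q t₀ → k * Q * t₀ ≡ t₀ * Q * k
          regroup = solve-∀

  ∃c-q^L∣order : ∃[ c ] (∀ L {d} → 2 ^ d ≡1mod q ^ (c + L) → q ^ L ∣ d)
  ∃c-q^L∣order with t₀ , c , b , 2^t₀≡ , q∤b ← ∃2^t₀≡1+q^[2+c]*b = 2 + c , q^i∣order {t₀} {c} {b} 2^t₀≡ q∤b

  bigDigits-% : ∀ J n → bigDigits J ((n % q ^ J) {{m^n≢0 q J}}) ≡ bigDigits J n
  bigDigits-% zero n = refl
  bigDigits-% (suc J) n = cong₂ _+_ (cong isBig lowest-digit) (trans (cong (bigDigits J) higher-digits) (bigDigits-% J (n / q)))
    where
    instance
      q^J≢0 : NonZero (q ^ J)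
      q^J≢0 = m^n≢0 q J
      q^[1+J]≢0 : NonZero (q ^ suc J)
      q^[1+J]≢0 = m^n≢0 q (suc J)
      q^J*q≢0 : NonZero (q ^ J * q)
      q^J*q≢0 = m*n≢0 (q ^ J) q
    lowest-digit : n % q ^ suc J % q ≡ n % q
    lowest-digit = m∣n⇒o%n%m≡o%m q (q ^ suc J) n (divides (q ^ J) (*-comm q (q ^ J)))
    higher-digits : n % q ^ suc J / q ≡ n / q % q ^ J
    higher-digits = trans (cong (_/ q) (%-congʳ (*-comm q (q ^ J)))) (m%[n*o]/o≡m/o%n n (q ^ J) q)

  Bad⇒bigDigits<K : ∀ J {K s} → Bad q K s ≡ true → bigDigits J (2 ^ s) < K
  Bad⇒bigDigits<K J {K} {s} Bad-s with q ^ K ∣? centralBinom2 s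
  ... | no q^K∤C = ≰⇒> λ K≤bigDigits → q^K∤C (∣-trans (^-monoʳ-∣ q K≤bigDigits)
          (subst (λ n → q ^ bigDigits J (2 ^ s) ∣ n C (2 ^ s)) (cong (2 ^ s +_) (sym (+-identityʳ (2 ^ s))))
            (q^bigDigits∣central-binomial J (2 ^ s))))

  module _ {c : ℕ} (q^L∣order : ∀ L {d} → 2 ^ d ≡1mod q ^ (c + L) → q ^ L ∣ d) where

    -- 2 ^ s mod q ^ (c + L) separates the q ^ L values of s in a window.
    count-Bad-window : ∀ K L s₀ → count (λ i → Bad q K (s₀ + i)) (q ^ L) ≤ countFewBig (c + L) K
    count-Bad-window K L s₀ = count-≤-injection (λ i → Bad q K (s₀ + i)) (fewBig J K) residue (q ^ L) (q ^ J) into injective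
      where
      J : ℕ
      J = c + L
      instance
        q^J≢0 : NonZero (q ^ J)
        q^J≢0 = m^n≢0 q J
      residue : ℕ → ℕ
      residue i = 2 ^ (s₀ + i) % q ^ J
      into : ∀ i → i < q ^ L → Bad q K (s₀ + i) ≡ true → residue i < q ^ J × fewBig J K (residue i) ≡ true
      into i _ Bad-s = m%n<n (2 ^ (s₀ + i)) (q ^ J) , Equivalence.to T-≡
        (<⇒<ᵇ (subst (_< K) (sym (bigDigits-% J (2 ^ (s₀ + i)))) (Bad⇒bigDigits<K J {s = s₀ + i} Bad-s)))
      distinct : ∀ {i j} → i < j → j < q ^ L → residue i ≢ residue j
      distinct {i} {j} i<j j<q^L same = <⇒≱ (≤-<-trans (m∸n≤m j i) j<q^L)
        (∣⇒≤ {{>-nonZero (m<n⇒0<n∸m i<j)}} (q^L∣order L (2^s≡2^[s+d]⇒2^d≡1 (q^n∣2^s*X⇒q^n∣X J) (s₀ + i) (j ∸ i)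
          (trans same (cong (λ z → 2 ^ z % q ^ J) (trans (cong (s₀ +_) (sym (m+[n∸m]≡n (<⇒≤ i<j)))) (sym (+-assoc s₀ i (j ∸ i)))))))))
      injective : InjectiveOn (λ i → Bad q K (s₀ + i)) residue (q ^ L)
      injective {i} {j} i<q^L j<q^L _ _ same with <-cmp i j
      ... | tri< i<j _ _ = contradiction same (distinct i<j j<q^L)
      ... | tri≈ _ i≡j _ = i≡j
      ... | tri> _ _ j<i = contradiction (sym same) (distinct j<i i<q^L)

    count-Bad-≤ : ∀ K L → count (Bad q K) (q * q ^ L) ≤ q * countFewBig (c + L) K
    count-Bad-≤ K L = begin
      count (Bad q K) (q * q ^ L)                                          ≡⟨ ∑-block (fromBool ∘ Bad q K) q (q ^ L) ⟩
      ∑ (λ i → ∑ (λ j → fromBool (Bad q K (i * q ^ L + j))) (q ^ L)) q     ≤⟨ ∑-mono-≤ q (λ i _ → count-Bad-window K L (i * q ^ L)) ⟩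
      ∑ (λ _ → countFewBig (c + L) K) q                                  ≡⟨ ∑-const _ q ⟩
      q * countFewBig (c + L) K                                          ∎
      where open ≤-Reasoning

  Bad-negligible : ∀ K {u v} → h ^ v < q ^ u → Negligible u v (count (Bad q K))
  Bad-negligible K {u} {v} hᵛ<qᵘ with c , q^L∣order ← ∃c-q^L∣order | w , 1≤w , [h[w+1]]ᵛ< ← ∃w[h[1+1/w]]^v< h v (q ^ u) hᵛ<qᵘ =
    negligible-by-⌊log⌋ {q} {u} {v} {w} {M} (q * w ^ K * M ^ c) (count (Bad q K)) (<⇒≤ 2<q) 1≤w 1≤M [h[w+1]]ᵛ< bound
    where
    M : ℕ
    M = h * (w + 1)
    1≤M : 1 ≤ M
    1≤M = *-mono-≤ {1} {h} (s≤s z≤n) (m≤n+m 1 w)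
    bound : ∀ L a → q ^ L ≤ a → a < q ^ suc L → count (Bad q K) a * w ^ L ≤ q * w ^ K * M ^ c * M ^ L
    bound L a _ a<q^[1+L] = begin
      count (Bad q K) a * w ^ L                          ≤⟨ *-monoˡ-≤ (w ^ L) (∑-monoʳ-≤ _ (<⇒≤ a<q^[1+L])) ⟩
      count (Bad q K) (q * q ^ L) * w ^ L                ≤⟨ *-mono-≤ (count-Bad-≤ {c} q^L∣order K L) w^L≤w^[c+L] ⟩
      q * countFewBig (c + L) K * w ^ (c + L)          ≡⟨ *-assoc q _ _ ⟩
      q * (countFewBig (c + L) K * w ^ (c + L))        ≤⟨ *-monoʳ-≤ q (countFewBig-bound w 1≤w (c + L) K) ⟩
      q * (w ^ K * M ^ (c + L))                        ≡⟨ cong (λ z → q * (w ^ K * z)) (^-distribˡ-+-* M c L) ⟩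
      q * (w ^ K * (M ^ c * M ^ L))                    ≡⟨ regroup q (w ^ K) (M ^ c) (M ^ L) ⟩
      q * w ^ K * M ^ c * M ^ L                        ∎
      where
      open ≤-Reasoning
      w^L≤w^[c+L] : w ^ L ≤ w ^ (c + L)
      w^L≤w^[c+L] = ^-monoʳ-≤ w {{>-nonZero 1≤w}} (m≤n+m L c)
      regroup : ∀ a b c d → a * (b * (c * d)) ≡ a * b * c * d
      regroup = solve-∀

-- All prime divisors of m

BadFor : ℕ → ℕ → ℕ → Bool
BadFor m q s = does (prime? q) ∧ does (q ∣? m) ∧ Bad q m s

BadFor-prime-divisor : ∀ {m q} s → Prime q → q ∣ m → BadFor m q s ≡ false → q ^ m ∣ centralBinom2 s
BadFor-prime-divisor {m} {q} s q-prime q∣m not-bad with prime? q | q ∣? m | q ^ m ∣? centralBinom2 s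
... | _ | _ | yes q^m∣C = q^m∣C
... | no q-composite | _ | no _ = contradiction q-prime q-composite
... | yes _ | no q∤m | no _ = contradiction q∣m q∤m
... | yes _ | yes _ | no _ with () ← not-bad

Cm≤∑BadFor : ∀ m → 1 ≤ m → ∀ a → Cm m a ≤ ∑ (λ q → count (BadFor m q) a) (suc m)
Cm≤∑BadFor m 1≤m a = begin
  Cm m a                                                    ≡⟨ length-filter (λ s → ¬? (m ∣? centralBinom2 s)) id a ⟩
  count (λ s → does (¬? (m ∣? centralBinom2 s))) a          ≤⟨ ∑-mono-≤ a (λ s _ → some-prime-bad s) ⟩
  ∑ (λ s → ∑ (λ q → fromBool (BadFor m q s)) (suc m)) a     ≡⟨ ∑-swap (λ s q → fromBool (BadFor m q s)) a (suc m) ⟩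
  ∑ (λ q → count (BadFor m q) a) (suc m)                    ∎
  where
  open ≤-Reasoning
  some-prime-bad : ∀ s → fromBool (does (¬? (m ∣? centralBinom2 s))) ≤ ∑ (λ q → fromBool (BadFor m q s)) (suc m)
  some-prime-bad s with m ∣? centralBinom2 s
  ... | yes _ = z≤n
  ... | no m∤C with ∑ (λ q → fromBool (BadFor m q s)) (suc m) in ∑≡
  ...   | suc _ = s≤s z≤n
  ...   | zero = contradiction (all-prime^m∣⇒m∣ m 1≤m (centralBinom2 s) prime^m∣C) m∤C
    where
    prime^m∣C : ∀ q → Prime q → q ∣ m → q ^ m ∣ centralBinom2 s
    prime^m∣C q q-prime q∣m = BadFor-prime-divisor s q-prime q∣m (fromBool≡0 (n≤0⇒n≡0
      (subst (fromBool (BadFor m q s) ≤_) ∑≡ (term≤∑ (λ q → fromBool (BadFor m q s)) (s≤s (∣⇒≤ {{>-nonZero 1≤m}} q∣m))))))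
      where
      fromBool≡0 : ∀ {b} → fromBool b ≡ 0 → b ≡ false
      fromBool≡0 {false} _ = refl

odd-prime-form : ∀ {m q} → m % 2 ≡ 1 → Prime q → q ∣ m → ∃[ h′ ] (q ≡ suc (h′ + h′))
odd-prime-form {m} {q} m-odd q-prime q∣m = q / 2 , (begin-equality
  q                          ≡⟨ m≡m%n+[m/n]*n q 2 ⟩
  q % 2 + q / 2 * 2          ≡⟨ cong (_+ q / 2 * 2) q-odd ⟩
  1 + q / 2 * 2              ≡⟨ cong suc (trans (*-comm (q / 2) 2) (cong (q / 2 +_) (+-identityʳ (q / 2)))) ⟩
  suc (q / 2 + q / 2)        ∎)
  where
  open ≤-Reasoning
  q-odd : q % 2 ≡ 1
  q-odd with q % 2 in q%2≡ | m%n<n q 2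
  ... | 1 | _ = refl
  ... | 0 | _ = contradiction (trans (sym m-odd) (n∣m⇒m%n≡0 m 2 (∣-trans (m%n≡0⇒n∣m q 2 q%2≡) q∣m))) λ ()
  ... | suc (suc _) | s≤s (s≤s ())

aboveExponent⇒h^v<q^u : ∀ {q h′ u v} → q ≡ suc (h′ + h′) → AboveExponent q u v → suc h′ ^ v < q ^ u
aboveExponent⇒h^v<q^u {q} {h′} {u} {v} q≡1+2h′ above = *-cancelʳ-< (2 ^ v) _ _ (begin-strict
  suc h′ ^ v * 2 ^ v     ≡⟨ ^-distribʳ-* (suc h′) 2 v ⟨
  (suc h′ * 2) ^ v       ≡⟨ cong (_^ v) (trans (double h′) (trans (cong suc (sym q≡1+2h′)) (+-comm 1 q))) ⟩
  (q + 1) ^ v            <⟨ above ⟩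
  q ^ u * 2 ^ v          ∎)
  where
  open ≤-Reasoning
  double : ∀ h′ → suc h′ * 2 ≡ suc (suc (h′ + h′))
  double = solve-∀

BadFor-negligible : ∀ {m p u v} → m % 2 ≡ 1 → IsGreatestPrimeFactor p m → 0 < v → AboveExponent p u v →
  ∀ q → Negligible u v (count (BadFor m q))
BadFor-negligible {m} {u = u} {v} m-odd (_ , _ , q≤p) 0<v above-p q with prime? q | q ∣? m
... | no _ | _ = negligible-≤ (≤-reflexive ∘ ∑-zero) (negligible-0 0<v)
... | yes _ | no _ = negligible-≤ (≤-reflexive ∘ ∑-zero) (negligible-0 0<v)
... | yes q-prime | yes q∣m with h′ , q≡1+2h′ ← odd-prime-form m-odd q-prime q∣m =
  OddPrime.Bad-negligible q h′ q-prime q≡1+2h′ m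
    (aboveExponent⇒h^v<q^u {u = u} {v} q≡1+2h′
      (aboveExponent-downward {u = u} {v} (nonTrivial⇒n>1 q {{prime⇒nonTrivial q-prime}}) (q≤p q q-prime q∣m) above-p))

Cm-negligible : ∀ {m p u v} → m % 2 ≡ 1 → 1 < m → IsGreatestPrimeFactor p m → 0 < v → AboveExponent p u v →
  Negligible u v (Cm m)
Cm-negligible {m} {u = u} {v} m-odd 1<m greatest 0<v above-p = negligible-≤ (Cm≤∑BadFor m (<⇒≤ 1<m))
  (negligible-∑ (suc m) (λ q → count (BadFor m q)) z<s (λ q _ → BadFor-negligible {u = u} {v} m-odd greatest 0<v above-p q))

theorem3p4 : ∀ (m : ℕ) → m % 2 ≡ 1 → 1 < m → ∀ (p : ℕ) → IsGreatestPrimeFactor p m →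
    ∀ (u v : ℕ) → 0 < v → AboveExponent p u v →
    ∀ (d e : ℕ) → 0 < d → 0 < e →
    ∃[ N ] (∀ (a : ℕ) → N ≤ a → (e * Cm m a) ^ v < d ^ v * a ^ u)
theorem3p4 m m-odd 1<m p greatest u v 0<v above-p d e 0<d _
  with N , eventually ← eventually-below (Cm-negligible {u = u} {v} m-odd 1<m greatest 0<v above-p) e =
  N , λ a N≤a → <-≤-trans (eventually a N≤a) (m≤n*m (a ^ u) (d ^ v) {{m^n≢0 d v {{>-nonZero 0<d}}}})
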